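{- Let $\Gamma$ be a finite simple graph with exactly $r$ main eigenvalues. Then the cone over $\Gamma$ has at most $r+1$ main eigenvalues.
   Context: Eigenvalues of a graph are those of its adjacency matrix $A$; $\mathbf{j}$ denotes the all-ones vector. An eigenvalue $\sigma$ of $A$ is a main eigenvalue if there is an eigenvector $\mathbf{x}$ for $\sigma$ with $\mathbf{x}^{\top}\mathbf{j}\neq 0$. The cone over $\Gamma$ is the graph obtained from $\Gamma$ by adding one new vertex adjacent to all vertices of $\Gamma$. -}

module Defs where

open import Level using (Level; _⊔_)
open import Data.Nat using (ℕ; zero; suc)
open import Data.Fin using (Fin; zero; suc)
open import Data.Bool using (Bool; true; false; if_then_else_)
open import Data.List using (List; []; _∷_; length)
open import Data.List.Relation.Unary.AllPairs using (AllPairs)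
open import Data.List.Relation.Unary.All using (All)
open import Data.Product using (Σ; ∃; _×_; _,_)
open import Relation.Nullary using (¬_)
open import Relation.Binary.PropositionalEquality using (_≡_)
open import Algebra.Bundles using (CommutativeRing)
import Data.List.Membership.Setoid
import Data.Nat

record Graph (n : ℕ) : Set where
  field
    adj   : Fin n → Fin n → Bool
    sym   : ∀ i j → adj i j ≡ adj j i
    loopless : ∀ i → adj i i ≡ false
open Graph public

-- The cone over Γ: new vertex `zero`, old vertex i becomes `suc i`.
coneAdj : ∀ {n} → Graph n → Fin (suc n) → Fin (suc n) → Bool
coneAdj Γ zero    zero    = false
coneAdj Γ zero    (suc j) = true
coneAdj Γ (suc i) zero    = true
coneAdj Γ (suc i) (suc j) = adj Γ i j

cone : ∀ {n} → Graph n → Graph (suc n)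
cone Γ = record { adj = coneAdj Γ ; sym = s ; loopless = l }
  where
  s : ∀ i j → coneAdj Γ i j ≡ coneAdj Γ j i
  s zero    zero    = Relation.Binary.PropositionalEquality.refl
  s zero    (suc j) = Relation.Binary.PropositionalEquality.refl
  s (suc i) zero    = Relation.Binary.PropositionalEquality.refl
  s (suc i) (suc j) = sym Γ i j
  l : ∀ i → coneAdj Γ i i ≡ false
  l zero    = Relation.Binary.PropositionalEquality.refl
  l (suc i) = loopless Γ i

module _ {c ℓ : Level} (R : CommutativeRing c ℓ) where
  open CommutativeRing R hiding (zero; sym)

  ∑ : ∀ {n} → (Fin n → Carrier) → Carrier
  ∑ {zero}  f = 0#
  ∑ {suc n} f = f zero + ∑ (λ i → f (suc i))

  IsField : Set (c ⊔ ℓ)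
  IsField = (¬ (1# ≈ 0#)) × (∀ x → ¬ (x ≈ 0#) → ∃ λ y → x * y ≈ 1#)

  natCast : ℕ → Carrier
  natCast zero    = 0#
  natCast (suc k) = 1# + natCast k

  CharZero : Set ℓ
  CharZero = ∀ k → ¬ (natCast (suc k) ≈ 0#)

  -- evaluate the monic polynomial x^(length cs) + Σ_i cs_i x^i,
  -- coefficients listed from the constant term upward
  evalMonic : List Carrier → Carrier → Carrier
  evalMonic []       x = 1#
  evalMonic (c ∷ cs) x = c + x * evalMonic cs x

  AlgClosed : Set (c ⊔ ℓ)
  AlgClosed = ∀ (cs : List Carrier) → ¬ (cs ≡ []) → ∃ λ x → evalMonic cs x ≈ 0#

  adjMul : ∀ {n} → Graph n → (Fin n → Carrier) → Fin n → Carrier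
  adjMul Γ x i = ∑ (λ j → if adj Γ i j then x j else 0#)

  IsEigenvector : ∀ {n} → Graph n → Carrier → (Fin n → Carrier) → Set ℓ
  IsEigenvector Γ σ x =
    (¬ (∀ i → x i ≈ 0#)) × (∀ i → adjMul Γ x i ≈ σ * x i)

  IsMainEigenvalue : ∀ {n} → Graph n → Carrier → Set (c ⊔ ℓ)
  IsMainEigenvalue Γ σ = ∃ λ x → IsEigenvector Γ σ x × (¬ (∑ x ≈ 0#))

  MainEigenvaluesAre : ∀ {n} → Graph n → List Carrier → Set (c ⊔ ℓ)
  MainEigenvaluesAre Γ σs =
    AllPairs (λ a b → ¬ (a ≈ b)) σs
    × All (IsMainEigenvalue Γ) σs
    × (∀ σ → IsMainEigenvalue Γ σ → Data.List.Membership.Setoid._∈_ setoid σ σs)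

  HasExactlyMain : ∀ {n} → Graph n → ℕ → Set (c ⊔ ℓ)
  HasExactlyMain Γ r = ∃ λ σs → MainEigenvaluesAre Γ σs × length σs ≡ r

  HasAtMostMain : ∀ {n} → Graph n → ℕ → Set (c ⊔ ℓ)
  HasAtMostMain Γ r = ∀ (σs : List Carrier) →
    AllPairs (λ a b → ¬ (a ≈ b)) σs → All (IsMainEigenvalue Γ) σs →
    length σs Data.Nat.≤ r

-- Let A be the adjacency matrix of Γ and j the all-ones vector.  Over ℚ the
-- Lanczos recurrence produces monic polynomials p₀, p₁, … with pₖ(A) j orthogonal
-- to j, A j, …, A^(k-1) j.  Since ℚ is ordered these vectors stay nonzero until the
-- first d for which m = p_d annihilates j, and Bessel's inequality gives d ≤ n.
-- In F every root ρ of m is a main eigenvalue of Γ: (m / (x − ρ))(A) j is an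
-- eigenvector whose pairing with p_(d-1)(A) j is nonzero.  The roots are simple:
-- if π is a rational polynomial of least degree vanishing at ρ then m = s π and
-- π′(ρ) ≠ 0, while s(ρ) = 0 would make s(A) j a nonzero rational vector of length
-- zero.  As F is algebraically closed, Γ has at least d main eigenvalues, so
-- d ≤ r.  Finally, if (y, x) is an eigenvector of the cone for μ with nonzero
-- coordinate sum then y ≠ 0, and pairing x with m(A) j = 0 shows that μ is a root
-- of a monic polynomial of degree d + 1.

{-# OPTIONS --safe #-}

module Submission where

open import Defs
open import Level using (Level; _⊔_; 0ℓ)
open import Algebra.Bundles using (CommutativeRing)
open import Algebra.Morphism.Structures using (module RingMorphisms)
import Algebra.Morphism.Construct.Composition as Composition
open import Algebra.Solver.Ring.AlmostCommutativeRing
  using (fromCommutativeRing; _-Raw-AlmostCommutative⟶_)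
open import Data.Bool using (Bool; true; false; if_then_else_)
open import Data.Empty using (⊥-elim)
open import Data.Fin using (Fin; zero; suc; toℕ)
import Data.Fin.Properties as Fin
open import Data.Integer as ℤ using (ℤ; +_; -[1+_]; _⊖_; 0ℤ; 1ℤ)
import Data.Integer.Properties as ℤ
open import Data.List using (List; []; _∷_; _∷ʳ_; length; map; tabulate)
import Data.List.Properties as List
open import Data.List.Relation.Unary.All as All using (All; []; _∷_)
import Data.List.Relation.Unary.All.Properties as All
open import Data.List.Relation.Unary.AllPairs using (AllPairs; []; _∷_)
import Data.List.Relation.Unary.AllPairs.Properties as AllPairs
open import Data.List.Relation.Unary.Any using (here; there)
open import Data.Maybe using (Maybe; just; nothing)
open import Data.Nat as ℕ using (ℕ; zero; suc; _≤_; _<_; z≤n; s≤s)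
import Data.Nat.Coprimality as Coprime
open import Data.Nat.Induction using (<-rec)
import Data.Nat.Properties as ℕ
open import Data.Product using (Σ; _×_; _,_; proj₁; proj₂)
open import Data.Rational as ℚ using (ℚ; mkℚ; 0ℚ; 1ℚ)
import Data.Rational.Properties as ℚ
open import Data.Rational.Unnormalised as ℚᵘ using (ℚᵘ; mkℚᵘ; *≡*)
open import Data.Sum using (_⊎_; inj₁; inj₂; [_,_]′)
open import Function using (_∘_)
open import Relation.Binary.Bundles using (Setoid)
open import Relation.Binary.PropositionalEquality as ≡ using (_≡_; _≢_)
open import Relation.Nullary using (¬_; yes; no; Dec)

length-∷ʳ : ∀ {a} {A : Set a} (xs : List A) x → length (xs ∷ʳ x) ≡ suc (length xs)
length-∷ʳ []       x = ≡.refl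
length-∷ʳ (_ ∷ xs) x = ≡.cong suc (length-∷ʳ xs x)

unsnoc : ∀ {a} {A : Set a} {k} (xs : List A) → length xs ≡ suc k →
         Σ (List A) λ ys → Σ A λ y → xs ≡ ys ∷ʳ y × length ys ≡ k


unsnoc {k = zero}  (x ∷ [])     ≡.refl = [] , x , ≡.refl , ≡.refl
unsnoc {k = suc k} (x ∷ x′ ∷ xs) |xs|≡ with unsnoc (x′ ∷ xs) (ℕ.suc-injective |xs|≡)
... | ys , y , xs≡ , |ys|≡k = x ∷ ys , y , ≡.cong (x ∷_) xs≡ , ≡.cong suc |ys|≡k

first-or-none : ∀ {p} (P : ℕ → Set p) → (∀ k → Dec (P k)) → ∀ N →
                (Σ ℕ λ d → d < N × P d × (∀ i → i < d → ¬ P i)) ⊎ (∀ i → i < N → ¬ P i)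


first-or-none P P? zero    = inj₂ (λ i ())
first-or-none P P? (suc N) with first-or-none P P? N
... | inj₁ (d , d<N , Pd , ¬P) = inj₁ (d , ℕ.m≤n⇒m≤1+n d<N , Pd , ¬P)
... | inj₂ ¬P with P? N
...   | yes PN  = inj₁ (N , ℕ.≤-refl , PN , ¬P)
...   | no  ¬PN = inj₂ λ i i<1+N → [ ¬P i , (λ { ≡.refl → ¬PN }) ]′ (ℕ.m<1+n⇒m<n∨m≡n i<1+N)

¬¬-least : ∀ {p} (P : ℕ → Set p) k → P k → ¬ ¬ (Σ ℕ λ m → P m × (∀ i → i < m → ¬ P i))
¬¬-least P k Pk no-least = <-rec (λ k → ¬ P k) (λ k smaller Pk → no-least (k , Pk , λ i i<k → smaller i<k)) k Pk


module RingKit {c ℓ : Level} (R : CommutativeRing c ℓ) where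

  open CommutativeRing R public
    renaming (refl to ≈-refl; sym to ≈-sym; trans to ≈-trans; zero to *-zero)
  open import Algebra.Properties.Ring ring public
  open import Relation.Binary.Reasoning.Setoid setoid public
  open import Algebra.Properties.Semiring.Mult.TCOptimised semiring public
    using (1+×; ×-congʳ) renaming (_×_ to _×ₙ_)
  open import Algebra.Properties.Semiring.Mult.TCOptimised semiring using (×-homo-+)
  open import Algebra.Properties.CommutativeSemigroup +-commutativeSemigroup using (interchange)

  natCast≈×ₙ : ∀ k → natCast R k ≈ k ×ₙ 1#
  natCast≈×ₙ zero    = ≈-refl
  natCast≈×ₙ (suc k) = ≈-trans (+-congˡ (natCast≈×ₙ k)) (≈-sym (1+× k 1#))

  fromℤ : ℤ → Carrier
  fromℤ (+ n)    = n ×ₙ 1#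
  fromℤ -[1+ n ] = - (suc n ×ₙ 1#)

  private
    fromℤ-⊖ : ∀ m n → fromℤ (m ⊖ n) ≈ m ×ₙ 1# - n ×ₙ 1#
    fromℤ-⊖ m       zero    = ≈-sym (≈-trans (+-congˡ -0#≈0#) (+-identityʳ _))
    fromℤ-⊖ zero    (suc n) = ≈-sym (+-identityˡ _)
    fromℤ-⊖ (suc m) (suc n) = begin
      fromℤ (suc m ⊖ suc n)            ≡⟨ ≡.cong fromℤ (ℤ.[1+m]⊖[1+n]≡m⊖n m n) ⟩
      fromℤ (m ⊖ n)                    ≈⟨ fromℤ-⊖ m n ⟩
      m ×ₙ 1# - n ×ₙ 1#                  ≈⟨ cancel 1# (m ×ₙ 1#) (n ×ₙ 1#) ⟨
      (1# + m ×ₙ 1#) - (1# + n ×ₙ 1#)    ≈⟨ +-cong (1+× m 1#) (-‿cong (1+× n 1#)) ⟨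
      suc m ×ₙ 1# - suc n ×ₙ 1#          ∎
      where
      cancel : ∀ a x y → (a + x) - (a + y) ≈ x - y
      cancel a x y = begin
        (a + x) - (a + y)      ≈⟨ +-congˡ (-‿+-comm a y) ⟨
        (a + x) + (- a + - y)  ≈⟨ interchange a x (- a) (- y) ⟩
        (a - a) + (x - y)      ≈⟨ +-congʳ (-‿inverseʳ a) ⟩
        0# + (x - y)           ≈⟨ +-identityˡ _ ⟩
        x - y                  ∎

  fromℤ-+ : ∀ a b → fromℤ (a ℤ.+ b) ≈ fromℤ a + fromℤ b
  fromℤ-+ (+ m)    (+ n)    = ×-homo-+ 1# m n
  fromℤ-+ (+ m)    -[1+ n ] = fromℤ-⊖ m (suc n)
  fromℤ-+ -[1+ m ] (+ n)    = ≈-trans (fromℤ-⊖ n (suc m)) (+-comm _ _)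
  fromℤ-+ -[1+ m ] -[1+ n ] = begin
    - (suc (suc (m ℕ.+ n)) ×ₙ 1#)        ≈⟨ -‿cong (≈-trans (1+× (suc (m ℕ.+ n)) 1#) (+-congˡ (1+× (m ℕ.+ n) 1#))) ⟩
    - (1# + (1# + (m ℕ.+ n) ×ₙ 1#))     ≈⟨ -‿cong (+-congˡ (+-congˡ (×-homo-+ 1# m n))) ⟩
    - (1# + (1# + (m ×ₙ 1# + n ×ₙ 1#)))  ≈⟨ -‿cong (regroup 1# (m ×ₙ 1#) (n ×ₙ 1#)) ⟩
    - ((1# + m ×ₙ 1#) + (1# + n ×ₙ 1#))  ≈⟨ -‿+-comm _ _ ⟨
    - (1# + m ×ₙ 1#) + - (1# + n ×ₙ 1#)  ≈⟨ +-cong (-‿cong (1+× m 1#)) (-‿cong (1+× n 1#)) ⟨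
    - (suc m ×ₙ 1#) + - (suc n ×ₙ 1#)    ∎
    where
    regroup : ∀ a x y → a + (a + (x + y)) ≈ (a + x) + (a + y)
    regroup a x y = ≈-trans (≈-sym (+-assoc a a (x + y))) (interchange a a x y)

  fromℤ-neg : ∀ a → fromℤ (ℤ.- a) ≈ - fromℤ a
  fromℤ-neg (+ zero)  = ≈-sym -0#≈0#
  fromℤ-neg (+ suc n) = ≈-refl
  fromℤ-neg -[1+ n ]  = ≈-sym (-‿involutive _)

  private
    fromℤ-*-+ : ∀ n b → fromℤ (+ n ℤ.* b) ≈ n ×ₙ 1# * fromℤ b
    fromℤ-*-+ zero    b = ≈-trans (reflexive (≡.cong fromℤ (ℤ.*-zeroˡ b))) (≈-sym (zeroˡ _))
    fromℤ-*-+ (suc n) b = begin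
      fromℤ (+ suc n ℤ.* b)           ≡⟨ ≡.cong fromℤ (≡.trans (ℤ.*-distribʳ-+ b (+ 1) (+ n))
                                             (≡.cong (ℤ._+ (+ n ℤ.* b)) (ℤ.*-identityˡ b))) ⟩
      fromℤ (b ℤ.+ + n ℤ.* b)         ≈⟨ fromℤ-+ b (+ n ℤ.* b) ⟩
      fromℤ b + fromℤ (+ n ℤ.* b)     ≈⟨ +-cong (≈-sym (*-identityˡ _)) (fromℤ-*-+ n b) ⟩
      1# * fromℤ b + n ×ₙ 1# * fromℤ b ≈⟨ distribʳ _ _ _ ⟨
      (1# + n ×ₙ 1#) * fromℤ b         ≈⟨ *-congʳ (1+× n 1#) ⟨
      suc n ×ₙ 1# * fromℤ b            ∎

  fromℤ-* : ∀ a b → fromℤ (a ℤ.* b) ≈ fromℤ a * fromℤ b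
  fromℤ-* (+ n)    b = fromℤ-*-+ n b
  fromℤ-* -[1+ n ] b = begin
    fromℤ (-[1+ n ] ℤ.* b)          ≡⟨ ≡.cong fromℤ (ℤ.neg-distribˡ-* (+ suc n) b) ⟨
    fromℤ (ℤ.- (+ suc n ℤ.* b))     ≈⟨ fromℤ-neg (+ suc n ℤ.* b) ⟩
    - fromℤ (+ suc n ℤ.* b)         ≈⟨ -‿cong (fromℤ-*-+ (suc n) b) ⟩
    - (suc n ×ₙ 1# * fromℤ b)        ≈⟨ -‿distribˡ-* _ _ ⟩
    - (suc n ×ₙ 1#) * fromℤ b        ∎

  ℤ⟶R : CommutativeRing.rawRing ℤ.+-*-commutativeRing -Raw-AlmostCommutative⟶ fromCommutativeRing R
  ℤ⟶R = record
    { ⟦_⟧ = fromℤ ; +-homo = fromℤ-+ ; *-homo = fromℤ-* ; -‿homo = fromℤ-neg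
    ; 0-homo = ≈-refl ; 1-homo = ≈-refl }

  fromℤ-≟ : ∀ a b → Maybe (fromℤ a ≈ fromℤ b)
  fromℤ-≟ a b with a ℤ.≟ b
  ... | yes a≡b = just (reflexive (≡.cong fromℤ a≡b))
  ... | no _    = nothing

  open import Algebra.Solver.Ring (CommutativeRing.rawRing ℤ.+-*-commutativeRing)
    (fromCommutativeRing R) ℤ⟶R fromℤ-≟ public
    using (solve; _:=_; _:+_; _:*_; :-_; _:-_; con)

  IsIntegralDomain : Set (c ⊔ ℓ)
  IsIntegralDomain = ∀ x y → x * y ≈ 0# → ¬ (x ≈ 0#) → y ≈ 0#

  field⇒domain : IsField R → IsIntegralDomain
  field⇒domain (_ , inverse) x y xy≈0 x≉0 with inverse x x≉0
  ... | x⁻¹ , xx⁻¹≈1 = begin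
    y                ≈⟨ *-identityˡ y ⟨
    1# * y           ≈⟨ *-congʳ (≈-trans (*-comm x⁻¹ x) xx⁻¹≈1) ⟨
    (x⁻¹ * x) * y    ≈⟨ *-assoc x⁻¹ x y ⟩
    x⁻¹ * (x * y)    ≈⟨ *-congˡ xy≈0 ⟩
    x⁻¹ * 0#         ≈⟨ zeroʳ x⁻¹ ⟩
    0#               ∎


module Vectors {c ℓ : Level} (R : CommutativeRing c ℓ) where

  open RingKit R

  Vector : ℕ → Set c
  Vector n = Fin n → Carrier

  infix  4 _≈ᵥ_
  infixl 6 _+ᵥ_
  infixl 7 _·ᵥ_

  _≈ᵥ_ : ∀ {n} → Vector n → Vector n → Set ℓ
  x ≈ᵥ y = ∀ i → x i ≈ y i

  0ᵥ : ∀ {n} → Vector n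
  0ᵥ _ = 0#

  _+ᵥ_ : ∀ {n} → Vector n → Vector n → Vector n
  (x +ᵥ y) i = x i + y i

  _·ᵥ_ : ∀ {n} → Carrier → Vector n → Vector n
  (a ·ᵥ x) i = a * x i

  ∑-cong : ∀ {n} {f g : Vector n} → f ≈ᵥ g → ∑ R f ≈ ∑ R g
  ∑-cong {zero}  f≈g = ≈-refl
  ∑-cong {suc n} f≈g = +-cong (f≈g zero) (∑-cong (λ i → f≈g (suc i)))

  ∑-+ : ∀ {n} (f g : Vector n) → ∑ R (f +ᵥ g) ≈ ∑ R f + ∑ R g
  ∑-+ {zero}  f g = ≈-sym (+-identityʳ 0#)
  ∑-+ {suc n} f g = begin
    (f zero + g zero) + ∑ R (f' +ᵥ g')          ≈⟨ +-congˡ (∑-+ f' g') ⟩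
    (f zero + g zero) + (∑ R f' + ∑ R g')       ≈⟨ solve 4 (λ a b x y → (a :+ b) :+ (x :+ y) := (a :+ x) :+ (b :+ y))
                                                     ≈-refl (f zero) (g zero) (∑ R f') (∑ R g') ⟩
    (f zero + ∑ R f') + (g zero + ∑ R g')       ∎
    where
    f' g' : Vector n
    f' i = f (suc i)
    g' i = g (suc i)

  ∑-*ˡ : ∀ {n} a (f : Vector n) → ∑ R (a ·ᵥ f) ≈ a * ∑ R f
  ∑-*ˡ {zero}  a f = ≈-sym (zeroʳ a)
  ∑-*ˡ {suc n} a f = ≈-trans (+-congˡ (∑-*ˡ a (λ i → f (suc i)))) (≈-sym (distribˡ a _ _))

  ∑-0 : ∀ {n} {f : Vector n} → f ≈ᵥ 0ᵥ → ∑ R f ≈ 0#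
  ∑-0 {zero}  f≈0 = ≈-refl
  ∑-0 {suc n} f≈0 = ≈-trans (+-cong (f≈0 zero) (∑-0 (λ i → f≈0 (suc i)))) (+-identityʳ 0#)

  ∑-swap : ∀ {m n} (f : Fin m → Fin n → Carrier) → ∑ R (λ i → ∑ R (f i)) ≈ ∑ R (λ j → ∑ R (λ i → f i j))
  ∑-swap {zero} {n} f = ≈-sym (∑-0 {n} (λ _ → ≈-refl))
  ∑-swap {suc m} f = begin
    ∑ R (f zero) + ∑ R (λ i → ∑ R (f (suc i)))          ≈⟨ +-congˡ (∑-swap (λ i → f (suc i))) ⟩
    ∑ R (f zero) + ∑ R (λ j → ∑ R (λ i → f (suc i) j))  ≈⟨ ∑-+ (f zero) (λ j → ∑ R (λ i → f (suc i) j)) ⟨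
    ∑ R (λ j → f zero j + ∑ R (λ i → f (suc i) j))      ∎

  infix 5 ⟨_,_⟩

  ⟨_,_⟩ : ∀ {n} → Vector n → Vector n → Carrier
  ⟨ x , y ⟩ = ∑ R (λ i → x i * y i)

  ⟨⟩-cong : ∀ {n} {x x′ y y′ : Vector n} → x ≈ᵥ x′ → y ≈ᵥ y′ → ⟨ x , y ⟩ ≈ ⟨ x′ , y′ ⟩
  ⟨⟩-cong x≈x′ y≈y′ = ∑-cong (λ i → *-cong (x≈x′ i) (y≈y′ i))

  ⟨⟩-comm : ∀ {n} (x y : Vector n) → ⟨ x , y ⟩ ≈ ⟨ y , x ⟩
  ⟨⟩-comm x y = ∑-cong (λ i → *-comm (x i) (y i))

  ⟨⟩-+ˡ : ∀ {n} (x y z : Vector n) → ⟨ x +ᵥ y , z ⟩ ≈ ⟨ x , z ⟩ + ⟨ y , z ⟩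
  ⟨⟩-+ˡ x y z = ≈-trans (∑-cong (λ i → distribʳ (z i) (x i) (y i))) (∑-+ (λ i → x i * z i) (λ i → y i * z i))

  ⟨⟩-·ˡ : ∀ {n} a (x y : Vector n) → ⟨ a ·ᵥ x , y ⟩ ≈ a * ⟨ x , y ⟩
  ⟨⟩-·ˡ a x y = ≈-trans (∑-cong (λ i → *-assoc a (x i) (y i))) (∑-*ˡ a (λ i → x i * y i))

  ⟨⟩-+ʳ : ∀ {n} (x y z : Vector n) → ⟨ x , y +ᵥ z ⟩ ≈ ⟨ x , y ⟩ + ⟨ x , z ⟩
  ⟨⟩-+ʳ x y z = ≈-trans (⟨⟩-comm x _) (≈-trans (⟨⟩-+ˡ y z x) (+-cong (⟨⟩-comm y x) (⟨⟩-comm z x)))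

  ⟨⟩-·ʳ : ∀ {n} a (x y : Vector n) → ⟨ x , a ·ᵥ y ⟩ ≈ a * ⟨ x , y ⟩
  ⟨⟩-·ʳ a x y = ≈-trans (⟨⟩-comm x _) (≈-trans (⟨⟩-·ˡ a y x) (*-congˡ (⟨⟩-comm y x)))

  ⟨⟩-zeroˡ : ∀ {n} {x : Vector n} (y : Vector n) → x ≈ᵥ 0ᵥ → ⟨ x , y ⟩ ≈ 0#
  ⟨⟩-zeroˡ y x≈0 = ∑-0 (λ i → ≈-trans (*-congʳ (x≈0 i)) (zeroˡ (y i)))

  ⟨⟩-zeroʳ : ∀ {n} (x : Vector n) {y : Vector n} → y ≈ᵥ 0ᵥ → ⟨ x , y ⟩ ≈ 0#
  ⟨⟩-zeroʳ x y≈0 = ≈-trans (⟨⟩-comm x _) (⟨⟩-zeroˡ x y≈0)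


module Adjacency {c ℓ : Level} (R : CommutativeRing c ℓ) {n : ℕ} (Γ : Graph n) where

  open RingKit R
  open Vectors R

  A : Vector n → Vector n
  A = adjMul R Γ

  private
    entry : Bool → Carrier → Carrier
    entry b x = if b then x else 0#

  A-cong : ∀ {x y} → x ≈ᵥ y → A x ≈ᵥ A y
  A-cong x≈y i = ∑-cong (λ j → cong-entry (adj Γ i j) (x≈y j))
    where
    cong-entry : ∀ b {x y} → x ≈ y → entry b x ≈ entry b y
    cong-entry true  x≈y = x≈y
    cong-entry false _   = ≈-refl

  A-+ : ∀ x y → A (x +ᵥ y) ≈ᵥ A x +ᵥ A y
  A-+ x y i = ≈-trans (∑-cong (λ j → entry-+ (adj Γ i j))) (∑-+ (λ j → entry (adj Γ i j) (x j)) (λ j → entry (adj Γ i j) (y j)))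
    where
    entry-+ : ∀ b {u v} → entry b (u + v) ≈ entry b u + entry b v
    entry-+ true  = ≈-refl
    entry-+ false = ≈-sym (+-identityʳ 0#)

  A-· : ∀ a x → A (a ·ᵥ x) ≈ᵥ a ·ᵥ A x
  A-· a x i = ≈-trans (∑-cong (λ j → entry-* (adj Γ i j))) (∑-*ˡ a (λ j → entry (adj Γ i j) (x j)))
    where
    entry-* : ∀ b {u} → entry b (a * u) ≈ a * entry b u
    entry-* true  = ≈-refl
    entry-* false = ≈-sym (zeroʳ a)

  A-0 : ∀ {x} → x ≈ᵥ 0ᵥ → A x ≈ᵥ 0ᵥ
  A-0 x≈0 i = ∑-0 (λ j → entry-0 (adj Γ i j) (x≈0 j))
    where
    entry-0 : ∀ b {u} → u ≈ 0# → entry b u ≈ 0#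
    entry-0 true  u≈0 = u≈0
    entry-0 false _   = ≈-refl

  A-sym : ∀ x y → ⟨ A x , y ⟩ ≈ ⟨ x , A y ⟩
  A-sym x y = begin
    ∑ R (λ i → ∑ R (λ j → entry (adj Γ i j) (x j)) * y i)
      ≈⟨ ∑-cong (λ i → ≈-trans (*-comm _ (y i)) (≈-sym (∑-*ˡ (y i) (λ j → entry (adj Γ i j) (x j))))) ⟩
    ∑ R (λ i → ∑ R (λ j → y i * entry (adj Γ i j) (x j)))
      ≈⟨ ∑-swap (λ i j → y i * entry (adj Γ i j) (x j)) ⟩
    ∑ R (λ j → ∑ R (λ i → y i * entry (adj Γ i j) (x j)))
      ≈⟨ ∑-cong (λ j → ∑-cong (λ i → transpose (adj Γ i j) (adj Γ j i) (sym Γ i j))) ⟩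
    ∑ R (λ j → ∑ R (λ i → x j * entry (adj Γ j i) (y i)))
      ≈⟨ ∑-cong (λ j → ∑-*ˡ (x j) (λ i → entry (adj Γ j i) (y i))) ⟩
    ∑ R (λ j → x j * ∑ R (λ i → entry (adj Γ j i) (y i)))
      ∎
    where
    transpose : ∀ b b′ → b ≡ b′ → ∀ {u v} → v * entry b u ≈ u * entry b′ v
    transpose true  .true  ≡.refl = *-comm _ _
    transpose false .false ≡.refl = ≈-trans (zeroʳ _) (≈-sym (zeroʳ _))

  A^ : ℕ → Vector n → Vector n
  A^ zero    v = v
  A^ (suc k) v = A (A^ k v)

  A^-cong : ∀ k {x y} → x ≈ᵥ y → A^ k x ≈ᵥ A^ k y
  A^-cong zero    x≈y = x≈y
  A^-cong (suc k) x≈y = A-cong (A^-cong k x≈y)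


module Polynomials {c ℓ : Level} (R : CommutativeRing c ℓ) where

  open RingKit R
  open import Data.List.Relation.Binary.Equality.Setoid setoid public
    using (_≋_; []; _∷_; ≋-refl; ≋-sym; ≋-trans)

  Poly : Set c
  Poly = List Carrier

  -- eval τ f is the polynomial with coefficients f (constant term first) and
  -- leading coefficient τ in degree length f; a monic polynomial is represented by
  -- its lower coefficients and evaluated with τ = 1#, a plain coefficient list with τ = 0#.
  eval : Carrier → Poly → Carrier → Carrier
  eval τ []      x = τ
  eval τ (a ∷ f) x = a + x * eval τ f x

  evalMonic≡eval : ∀ f x → evalMonic R f x ≡ eval 1# f x
  evalMonic≡eval []      x = ≡.refl
  evalMonic≡eval (a ∷ f) x = ≡.cong (λ y → a + x * y) (evalMonic≡eval f x)

  eval-cong-top : ∀ {τ σ} f x → τ ≈ σ → eval τ f x ≈ eval σ f x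
  eval-cong-top []      x τ≈σ = τ≈σ
  eval-cong-top (a ∷ f) x τ≈σ = +-congˡ (*-congˡ (eval-cong-top f x τ≈σ))

  eval-cong-point : ∀ τ f {x y} → x ≈ y → eval τ f x ≈ eval τ f y
  eval-cong-point τ []      x≈y = ≈-refl
  eval-cong-point τ (a ∷ f) x≈y = +-congˡ (*-cong x≈y (eval-cong-point τ f x≈y))

  eval-cong : ∀ τ {f g} x → f ≋ g → eval τ f x ≈ eval τ g x
  eval-cong τ x []          = ≈-refl
  eval-cong τ x (a≈b ∷ f≋g) = +-cong a≈b (*-congˡ (eval-cong τ x f≋g))

  eval-∷ʳ : ∀ τ f a x → eval τ (f ∷ʳ a) x ≈ eval (a + x * τ) f x
  eval-∷ʳ τ []      a x = ≈-refl
  eval-∷ʳ τ (b ∷ f) a x = +-congˡ (*-congˡ (eval-∷ʳ τ f a x))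

  eval₀-∷ʳ : ∀ f a x → eval 0# (f ∷ʳ a) x ≈ eval a f x
  eval₀-∷ʳ f a x = ≈-trans (eval-∷ʳ 0# f a x) (eval-cong-top f x (≈-trans (+-congˡ (zeroʳ x)) (+-identityʳ a)))

  ∷ʳ-cong : ∀ f {a b} → a ≈ b → f ∷ʳ a ≋ f ∷ʳ b
  ∷ʳ-cong []      a≈b = a≈b ∷ []
  ∷ʳ-cong (c ∷ f) a≈b = ≈-refl ∷ ∷ʳ-cong f a≈b

  AllZero : Poly → Set (c ⊔ ℓ)
  AllZero = All (_≈ 0#)

  eval-AllZero : ∀ {f} x → AllZero f → eval 0# f x ≈ 0#
  eval-AllZero x []          = ≈-refl
  eval-AllZero x (a≈0 ∷ f≈0) = ≈-trans (+-cong a≈0 (≈-trans (*-congˡ (eval-AllZero x f≈0)) (zeroʳ x))) (+-identityʳ 0#)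

  AllZero-resp-≋ : ∀ {f g} → f ≋ g → AllZero f → AllZero g
  AllZero-resp-≋ []          []          = []
  AllZero-resp-≋ (a≈b ∷ f≋g) (a≈0 ∷ f≈0) = ≈-trans (≈-sym a≈b) a≈0 ∷ AllZero-resp-≋ f≋g f≈0

  padd : Poly → Poly → Poly
  padd []      g       = g
  padd (a ∷ f) []      = a ∷ f
  padd (a ∷ f) (b ∷ g) = a + b ∷ padd f g

  pscale : Carrier → Poly → Poly
  pscale a = map (a *_)

  psub : Poly → Poly → Poly
  psub f g = padd f (pscale (- 1#) g)

  pmul : Poly → Poly → Poly
  pmul []      g = []
  pmul (a ∷ f) g = padd (pscale a g) (0# ∷ pmul f g)

  length-padd-≤ : ∀ f g → length g ≤ length f → length (padd f g) ≡ length f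
  length-padd-≤ []      []      _         = ≡.refl
  length-padd-≤ (a ∷ f) []      _         = ≡.refl
  length-padd-≤ (a ∷ f) (b ∷ g) (s≤s g≤f) = ≡.cong suc (length-padd-≤ f g g≤f)

  length-psub-≤ : ∀ f g → length g ≤ length f → length (psub f g) ≡ length f
  length-psub-≤ f g g≤f = length-padd-≤ f _ (≡.subst (_≤ length f) (≡.sym (List.length-map _ g)) g≤f)

  private
    step-+ : ∀ a b x u v → (a + b) + x * (u + v) ≈ (a + x * u) + (b + x * v)
    step-+ = solve 5 (λ a b x u v → (a :+ b) :+ x :* (u :+ v) := (a :+ x :* u) :+ (b :+ x :* v)) ≈-refl

  eval-padd : ∀ f g x → eval 0# (padd f g) x ≈ eval 0# f x + eval 0# g x
  eval-padd []      g       x = ≈-sym (+-identityˡ _)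
  eval-padd (a ∷ f) []      x = ≈-sym (+-identityʳ _)
  eval-padd (a ∷ f) (b ∷ g) x =
    ≈-trans (+-congˡ (*-congˡ (eval-padd f g x))) (step-+ a b x (eval 0# f x) (eval 0# g x))

  eval-padd-≤ : ∀ τ f g x → length g ≤ length f → eval τ (padd f g) x ≈ eval τ f x + eval 0# g x
  eval-padd-≤ τ []      []      x _         = ≈-sym (+-identityʳ τ)
  eval-padd-≤ τ (a ∷ f) []      x _         = ≈-sym (+-identityʳ _)
  eval-padd-≤ τ (a ∷ f) (b ∷ g) x (s≤s g≤f) =
    ≈-trans (+-congˡ (*-congˡ (eval-padd-≤ τ f g x g≤f))) (step-+ a b x (eval τ f x) (eval 0# g x))

  eval-pscale : ∀ a τ f x → eval (a * τ) (pscale a f) x ≈ a * eval τ f x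
  eval-pscale a τ []      x = ≈-refl
  eval-pscale a τ (b ∷ f) x = begin
    a * b + x * eval (a * τ) (pscale a f) x  ≈⟨ +-congˡ (*-congˡ (eval-pscale a τ f x)) ⟩
    a * b + x * (a * eval τ f x)             ≈⟨ solve 4 (λ a b x u → a :* b :+ x :* (a :* u) := a :* (b :+ x :* u))
                                                  ≈-refl a b x (eval τ f x) ⟩
    a * (b + x * eval τ f x)                 ∎

  eval₀-pscale : ∀ a f x → eval 0# (pscale a f) x ≈ a * eval 0# f x
  eval₀-pscale a f x = ≈-trans (eval-cong-top (pscale a f) x (≈-sym (zeroʳ a))) (eval-pscale a 0# f x)

  eval-psub : ∀ f g x → eval 0# (psub f g) x ≈ eval 0# f x - eval 0# g x
  eval-psub f g x = begin
    eval 0# (psub f g) x                      ≈⟨ eval-padd f _ x ⟩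
    eval 0# f x + eval 0# (pscale (- 1#) g) x ≈⟨ +-congˡ (≈-trans (eval₀-pscale (- 1#) g x) (-1*x≈-x _)) ⟩
    eval 0# f x - eval 0# g x                 ∎

  eval-psub-≤ : ∀ τ f g x → length g ≤ length f → eval τ (psub f g) x ≈ eval τ f x - eval 0# g x
  eval-psub-≤ τ f g x g≤f = begin
    eval τ (psub f g) x                      ≈⟨ eval-padd-≤ τ f _ x (≡.subst (_≤ length f) (≡.sym (List.length-map _ g)) g≤f) ⟩
    eval τ f x + eval 0# (pscale (- 1#) g) x ≈⟨ +-congˡ (≈-trans (eval₀-pscale (- 1#) g x) (-1*x≈-x _)) ⟩
    eval τ f x - eval 0# g x                 ∎

  eval-pmul : ∀ f g x → eval 0# (pmul f g) x ≈ eval 0# f x * eval 0# g x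
  eval-pmul []      g x = ≈-sym (zeroˡ _)
  eval-pmul (a ∷ f) g x = begin
    eval 0# (padd (pscale a g) (0# ∷ pmul f g)) x         ≈⟨ eval-padd (pscale a g) _ x ⟩
    eval 0# (pscale a g) x + (0# + x * eval 0# (pmul f g) x)
                                                          ≈⟨ +-cong (eval₀-pscale a g x) (+-congˡ (*-congˡ (eval-pmul f g x))) ⟩
    a * G + (0# + x * (F * G))                            ≈⟨ solve 4 (λ a x F G → a :* G :+ (con 0ℤ :+ x :* (F :* G)) := (a :+ x :* F) :* G)
                                                               ≈-refl a x F G ⟩
    (a + x * F) * G                                       ∎
    where
    F = eval 0# f x
    G = eval 0# g x

  eval-reduce : ∀ τ f π x → length f ≡ length π →
                eval τ f x ≈ τ * eval 1# π x + eval 0# (psub f (pscale τ π)) x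
  eval-reduce τ []      []      x _ = ≈-sym (≈-trans (+-identityʳ _) (*-identityʳ τ))
  eval-reduce τ (a ∷ f) (b ∷ π) x |f|≡|π| = begin
    a + x * eval τ f x
      ≈⟨ +-congˡ (*-congˡ (eval-reduce τ f π x (ℕ.suc-injective |f|≡|π|))) ⟩
    a + x * (τ * eval 1# π x + eval 0# (psub f (pscale τ π)) x)
      ≈⟨ solve 6 (λ a b x τ P Q → a :+ x :* (τ :* P :+ Q) := τ :* (b :+ x :* P) :+ ((a :+ (:- con 1ℤ) :* (τ :* b)) :+ x :* Q))
           ≈-refl a b x τ (eval 1# π x) (eval 0# (psub f (pscale τ π)) x) ⟩
    τ * (b + x * eval 1# π x) + ((a + - 1# * (τ * b)) + x * eval 0# (psub f (pscale τ π)) x)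
      ∎

  private
    length-reduce : ∀ {π} f τ → length f ≡ length π → length (psub f (pscale τ π)) ≡ length π
    length-reduce {π} f τ |f|≡|π| =
      ≡.trans (length-psub-≤ f (pscale τ π) (ℕ.≤-reflexive (≡.trans (List.length-map _ π) (≡.sym |f|≡|π|)))) |f|≡|π|

  divide : ∀ π e τ f → length f ≡ e ℕ.+ length π →
           Σ Poly λ s → Σ Poly λ r → length s ≡ e × length r ≡ length π ×
             (∀ x → eval τ f x ≈ eval τ s x * eval 1# π x + eval 0# r x)
  divide π zero    τ f       |f|≡ = [] , psub f (pscale τ π) , ≡.refl , length-reduce f τ |f|≡ , λ x → eval-reduce τ f π x |f|≡
  divide π (suc e) τ (c ∷ f) |f|≡ with divide π e τ f (ℕ.suc-injective |f|≡)
  ... | s , r , |s|≡e , |r|≡k , f≈ with unsnoc (c ∷ r) (≡.cong suc |r|≡k)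
  ...   | r″ , t , c∷r≡ , |r″|≡k = t ∷ s , psub r″ (pscale t π) , ≡.cong suc |s|≡e , length-reduce r″ t |r″|≡k , identity
    where
    identity : ∀ x → eval τ (c ∷ f) x ≈ eval τ (t ∷ s) x * eval 1# π x + eval 0# (psub r″ (pscale t π)) x
    identity x = begin
      c + x * eval τ f x
        ≈⟨ +-congˡ (*-congˡ (f≈ x)) ⟩
      c + x * (eval τ s x * Π + eval 0# r x)
        ≈⟨ solve 5 (λ c x S Π R → c :+ x :* (S :* Π :+ R) := x :* S :* Π :+ (c :+ x :* R)) ≈-refl c x (eval τ s x) Π (eval 0# r x) ⟩
      x * eval τ s x * Π + eval 0# (c ∷ r) x
        ≈⟨ +-congˡ (≈-trans (reflexive (≡.cong (λ g → eval 0# g x) c∷r≡)) (eval₀-∷ʳ r″ t x)) ⟩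
      x * eval τ s x * Π + eval t r″ x
        ≈⟨ +-congˡ (eval-reduce t r″ π x |r″|≡k) ⟩
      x * eval τ s x * Π + (t * Π + eval 0# (psub r″ (pscale t π)) x)
        ≈⟨ solve 5 (λ x S Π t R → x :* S :* Π :+ (t :* Π :+ R) := (t :+ x :* S) :* Π :+ R) ≈-refl x (eval τ s x) Π t _ ⟩
      (t + x * eval τ s x) * Π + eval 0# (psub r″ (pscale t π)) x
        ∎
      where
      Π = eval 1# π x

  padd-cong : ∀ {f f′ g g′} → f ≋ f′ → g ≋ g′ → padd f g ≋ padd f′ g′
  padd-cong []          g≋g′        = g≋g′
  padd-cong (a≈ ∷ f≋f′) []          = a≈ ∷ f≋f′
  padd-cong (a≈ ∷ f≋f′) (b≈ ∷ g≋g′) = +-cong a≈ b≈ ∷ padd-cong f≋f′ g≋g′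

  pscale-cong : ∀ {a b f g} → a ≈ b → f ≋ g → pscale a f ≋ pscale b g
  pscale-cong a≈b []          = []
  pscale-cong a≈b (c≈ ∷ f≋g) = *-cong a≈b c≈ ∷ pscale-cong a≈b f≋g

  deflate : Carrier → Carrier → Poly → Poly
  deflate τ ρ []          = []
  deflate τ ρ (a ∷ [])    = []
  deflate τ ρ (a ∷ b ∷ f) = eval τ (b ∷ f) ρ ∷ deflate τ ρ (b ∷ f)

  length-deflate : ∀ τ ρ a f → length (deflate τ ρ (a ∷ f)) ≡ length f
  length-deflate τ ρ a []      = ≡.refl
  length-deflate τ ρ a (b ∷ f) = ≡.cong suc (length-deflate τ ρ b f)

  eval-deflate : ∀ τ ρ a f x → eval τ (a ∷ f) x ≈ (x - ρ) * eval τ (deflate τ ρ (a ∷ f)) x + eval τ (a ∷ f) ρ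
  eval-deflate τ ρ a []      x = solve 4 (λ a x ρ τ → a :+ x :* τ := (x :- ρ) :* τ :+ (a :+ ρ :* τ)) ≈-refl a x ρ τ
  eval-deflate τ ρ a (b ∷ f) x = begin
    a + x * eval τ (b ∷ f) x        ≈⟨ +-congˡ (*-congˡ (eval-deflate τ ρ b f x)) ⟩
    a + x * ((x - ρ) * Q + P)       ≈⟨ solve 5 (λ a x ρ Q P → a :+ x :* ((x :- ρ) :* Q :+ P) := (x :- ρ) :* (P :+ x :* Q) :+ (a :+ ρ :* P))
                                         ≈-refl a x ρ Q P ⟩
    (x - ρ) * (P + x * Q) + (a + ρ * P) ∎
    where
    P = eval τ (b ∷ f) ρ
    Q = eval τ (deflate τ ρ (b ∷ f)) x

  eval-deflate-root : ∀ τ ρ a f x → eval τ (a ∷ f) ρ ≈ 0# →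
                      eval τ (a ∷ f) x ≈ (x - ρ) * eval τ (deflate τ ρ (a ∷ f)) x
  eval-deflate-root τ ρ a f x root =
    ≈-trans (eval-deflate τ ρ a f x) (≈-trans (+-congˡ root) (+-identityʳ _))

  eval-deflate-deflate : ∀ τ ρ μ a b f x →
    eval τ (deflate τ μ (a ∷ b ∷ f)) x ≈
    (x - ρ) * eval τ (deflate τ μ (deflate τ ρ (a ∷ b ∷ f))) x + eval τ (deflate τ ρ (a ∷ b ∷ f)) μ
  eval-deflate-deflate τ ρ μ a b []      x =
    solve 5 (λ x ρ μ τ b → (b :+ μ :* τ) :+ x :* τ := (x :- ρ) :* τ :+ ((b :+ ρ :* τ) :+ μ :* τ))
      ≈-refl x ρ μ τ b
  eval-deflate-deflate τ ρ μ a b (c ∷ f) x = begin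
    Gμ + x * eval τ (deflate τ μ g) x      ≈⟨ +-congˡ (*-congˡ (eval-deflate-deflate τ ρ μ b c f x)) ⟩
    Gμ + x * ((x - ρ) * D + Qμ)           ≈⟨ +-congʳ (eval-deflate τ ρ b (c ∷ f) μ) ⟩
    ((μ - ρ) * Qμ + Gρ) + x * ((x - ρ) * D + Qμ)
                                          ≈⟨ solve 6 (λ x ρ μ D Qμ Gρ →
                                               ((μ :- ρ) :* Qμ :+ Gρ) :+ x :* ((x :- ρ) :* D :+ Qμ)
                                                 := (x :- ρ) :* (Qμ :+ x :* D) :+ (Gρ :+ μ :* Qμ))
                                               ≈-refl x ρ μ D Qμ Gρ ⟩
    (x - ρ) * (Qμ + x * D) + (Gρ + μ * Qμ) ∎
    where
    g  = b ∷ c ∷ f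
    Gμ = eval τ g μ
    Gρ = eval τ g ρ
    Qμ = eval τ (deflate τ ρ g) μ
    D  = eval τ (deflate τ μ (deflate τ ρ g)) x

  AllZero-deflate : ∀ {τ ρ} f → τ ≈ 0# → eval τ f ρ ≈ 0# → AllZero (deflate τ ρ f) → AllZero f
  AllZero-deflate []          τ≈0 root _              = []
  AllZero-deflate {τ} {ρ} (a ∷ []) τ≈0 root _ =
    ≈-trans (≈-sym (≈-trans (+-congˡ (≈-trans (*-congˡ τ≈0) (zeroʳ ρ))) (+-identityʳ a))) root ∷ []
  AllZero-deflate {τ} {ρ} (a ∷ b ∷ f) τ≈0 root (tail≈0 ∷ q≈0) =
    a≈0 ∷ AllZero-deflate (b ∷ f) τ≈0 tail≈0 q≈0
    where
    a≈0 : a ≈ 0#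
    a≈0 = ≈-trans (≈-sym (≈-trans (+-congˡ (≈-trans (*-congˡ tail≈0) (zeroʳ ρ))) (+-identityʳ a))) root

  Distinct : List Carrier → Set (c ⊔ ℓ)
  Distinct = AllPairs (λ x y → ¬ (x ≈ y))

  too-many-roots⇒zero : IsIntegralDomain → ∀ τ f ρs → length f < length ρs → Distinct ρs →
                        All (λ ρ → eval τ f ρ ≈ 0#) ρs → τ ≈ 0# × AllZero f
  too-many-roots⇒zero dom τ []      (ρ ∷ ρs) _         _              (root ∷ _)     = root , []
  too-many-roots⇒zero dom τ (a ∷ f) (ρ ∷ ρs) (s≤s f<ρs) (ρ≉ρs ∷ distinct) (root ∷ roots) =
    τ≈0 , AllZero-deflate (a ∷ f) τ≈0 root q≈0
    where
    q = deflate τ ρ (a ∷ f)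
    q-roots : ∀ {μs} → All (λ μ → ¬ (ρ ≈ μ)) μs → All (λ μ → eval τ (a ∷ f) μ ≈ 0#) μs →
              All (λ μ → eval τ q μ ≈ 0#) μs
    q-roots []              []              = []
    q-roots {μ ∷ _} (ρ≉μ ∷ ρ≉μs) (μ-root ∷ μs-roots) =
      dom (μ - ρ) _ (≈-trans (≈-sym (eval-deflate-root τ ρ a f μ root)) μ-root)
          (λ μ-ρ≈0 → ρ≉μ (≈-sym (x∙y⁻¹≈ε⇒x≈y μ ρ μ-ρ≈0)))
      ∷ q-roots ρ≉μs μs-roots
    IH : τ ≈ 0# × AllZero q
    IH = too-many-roots⇒zero dom τ q ρs (≡.subst (_< length ρs) (≡.sym (length-deflate τ ρ a f)) f<ρs)
           distinct (q-roots ρ≉ρs roots)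
    τ≈0 : τ ≈ 0#
    τ≈0 = proj₁ IH
    q≈0 : AllZero q
    q≈0 = proj₂ IH

  distinct-roots≤degree : IsIntegralDomain → ¬ (1# ≈ 0#) → ∀ h ρs → Distinct ρs →
                          All (λ ρ → eval 1# h ρ ≈ 0#) ρs → length ρs ≤ length h
  distinct-roots≤degree dom 1≉0 h ρs distinct roots with length ρs ℕ.≤? length h
  ... | yes ρs≤h = ρs≤h
  ... | no  ρs≰h = ⊥-elim (1≉0 (proj₁ (too-many-roots⇒zero dom 1# h ρs (ℕ.≰⇒> ρs≰h) distinct roots)))

  vanishing-everywhere⇒zero : IsIntegralDomain → (p : ℕ → Carrier) → (∀ {i j} → p i ≈ p j → i ≡ j) →
                              ∀ f → (∀ x → eval 0# f x ≈ 0#) → AllZero f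
  vanishing-everywhere⇒zero dom p p-injective f zero-function =
    proj₂ (too-many-roots⇒zero dom 0# f (tabulate point)
             (≡.subst (length f <_) (≡.sym (List.length-tabulate point)) ℕ.≤-refl)
             (AllPairs.tabulate⁺ {f = point} (λ i≢j pi≈pj → i≢j (Fin.toℕ-injective (p-injective pi≈pj))))
             (All.tabulate⁺ {f = point} (λ i → zero-function (point i))))
    where
    point : Fin (suc (length f)) → Carrier
    point i = p (toℕ i)

  weighted : ℕ → Poly → Poly
  weighted k []      = []
  weighted k (b ∷ g) = k ×ₙ b ∷ weighted (suc k) g

  derivative : Poly → Poly
  derivative []      = []
  derivative (a ∷ f) = weighted 1 f

  weighted-∷ʳ : ∀ k g t → weighted k (g ∷ʳ t) ≡ weighted k g ∷ʳ ((length g ℕ.+ k) ×ₙ t)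
  weighted-∷ʳ k []      t = ≡.refl
  weighted-∷ʳ k (b ∷ g) t =
    ≡.cong (k ×ₙ b ∷_) (≡.trans (weighted-∷ʳ (suc k) g t) (≡.cong (λ m → weighted (suc k) g ∷ʳ (m ×ₙ t)) (ℕ.+-suc (length g) k)))

  length-weighted : ∀ k g → length (weighted k g) ≡ length g
  length-weighted k []      = ≡.refl
  length-weighted k (b ∷ g) = ≡.cong suc (length-weighted (suc k) g)

  private
    eval-weighted-suc : ∀ k g x → eval 0# (weighted (suc k) g) x ≈ eval 0# (weighted k g) x + eval 0# g x
    eval-weighted-suc k []      x = ≈-sym (+-identityʳ 0#)
    eval-weighted-suc k (b ∷ g) x = begin
      suc k ×ₙ b + x * eval 0# (weighted (suc (suc k)) g) x            ≈⟨ +-cong (1+× k b) (*-congˡ (eval-weighted-suc (suc k) g x)) ⟩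
      (b + k ×ₙ b) + x * (eval 0# (weighted (suc k) g) x + eval 0# g x) ≈⟨ solve 5 (λ b kb x W G →
                                                                           (b :+ kb) :+ x :* (W :+ G) := (kb :+ x :* W) :+ (b :+ x :* G))
                                                                           ≈-refl b (k ×ₙ b) x _ _ ⟩
      (k ×ₙ b + x * eval 0# (weighted (suc k) g) x) + (b + x * eval 0# g x) ∎

  eval-derivative-∷ : ∀ a f x → eval 0# (derivative (a ∷ f)) x ≈ eval 0# f x + x * eval 0# (derivative f) x
  eval-derivative-∷ a []      x = ≈-sym (≈-trans (+-identityˡ _) (zeroʳ x))
  eval-derivative-∷ a (b ∷ g) x = begin
    b + x * eval 0# (weighted 2 g) x                            ≈⟨ +-congˡ (*-congˡ (eval-weighted-suc 1 g x)) ⟩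
    b + x * (eval 0# (weighted 1 g) x + eval 0# g x)           ≈⟨ solve 4 (λ b x W G → b :+ x :* (W :+ G) := (b :+ x :* G) :+ x :* W)
                                                                    ≈-refl b x _ _ ⟩
    (b + x * eval 0# g x) + x * eval 0# (weighted 1 g) x       ∎

  derivative-∷ʳ : ∀ a g t → derivative (a ∷ (g ∷ʳ t)) ≡ weighted 1 g ∷ʳ (suc (length g) ×ₙ t)
  derivative-∷ʳ a g t = ≡.trans (weighted-∷ʳ 1 g t) (≡.cong (λ m → weighted 1 g ∷ʳ (m ×ₙ t)) (ℕ.+-comm (length g) 1))

  eval-derivative-padd : ∀ f g x → eval 0# (derivative (padd f g)) x ≈ eval 0# (derivative f) x + eval 0# (derivative g) x
  eval-derivative-padd []      g       x = ≈-sym (+-identityˡ _)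
  eval-derivative-padd (a ∷ f) []      x = ≈-sym (+-identityʳ _)
  eval-derivative-padd (a ∷ f) (b ∷ g) x = begin
    eval 0# (derivative (a + b ∷ padd f g)) x                       ≈⟨ eval-derivative-∷ (a + b) (padd f g) x ⟩
    eval 0# (padd f g) x + x * eval 0# (derivative (padd f g)) x    ≈⟨ +-cong (eval-padd f g x) (*-congˡ (eval-derivative-padd f g x)) ⟩
    (F + G) + x * (DF + DG)                                         ≈⟨ step-+ F G x DF DG ⟩
    (F + x * DF) + (G + x * DG)                                     ≈⟨ +-cong (eval-derivative-∷ a f x) (eval-derivative-∷ b g x) ⟨
    eval 0# (derivative (a ∷ f)) x + eval 0# (derivative (b ∷ g)) x ∎
    where
    F = eval 0# f x
    G = eval 0# g x
    DF = eval 0# (derivative f) x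
    DG = eval 0# (derivative g) x

  eval-derivative-pscale : ∀ a f x → eval 0# (derivative (pscale a f)) x ≈ a * eval 0# (derivative f) x
  eval-derivative-pscale a []      x = ≈-sym (zeroʳ a)
  eval-derivative-pscale a (b ∷ f) x = begin
    eval 0# (derivative (a * b ∷ pscale a f)) x                      ≈⟨ eval-derivative-∷ (a * b) (pscale a f) x ⟩
    eval 0# (pscale a f) x + x * eval 0# (derivative (pscale a f)) x ≈⟨ +-cong (eval₀-pscale a f x) (*-congˡ (eval-derivative-pscale a f x)) ⟩
    a * F + x * (a * DF)                                             ≈⟨ solve 4 (λ a F x DF → a :* F :+ x :* (a :* DF) := a :* (F :+ x :* DF))
                                                                          ≈-refl a F x DF ⟩
    a * (F + x * DF)                                                 ≈⟨ *-congˡ (eval-derivative-∷ b f x) ⟨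
    a * eval 0# (derivative (b ∷ f)) x                               ∎
    where
    F = eval 0# f x
    DF = eval 0# (derivative f) x

  eval-derivative-pmul : ∀ f g x → eval 0# (derivative (pmul f g)) x ≈
                         eval 0# (derivative f) x * eval 0# g x + eval 0# f x * eval 0# (derivative g) x
  eval-derivative-pmul []      g x = solve 2 (λ G DG → con 0ℤ := con 0ℤ :* G :+ con 0ℤ :* DG) ≈-refl (eval 0# g x) _
  eval-derivative-pmul (a ∷ f) g x = begin
    eval 0# (derivative (padd (pscale a g) (0# ∷ pmul f g))) x
      ≈⟨ eval-derivative-padd (pscale a g) (0# ∷ pmul f g) x ⟩
    eval 0# (derivative (pscale a g)) x + eval 0# (derivative (0# ∷ pmul f g)) x
      ≈⟨ +-cong (eval-derivative-pscale a g x) (eval-derivative-∷ 0# (pmul f g) x) ⟩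
    a * DG + (eval 0# (pmul f g) x + x * eval 0# (derivative (pmul f g)) x)
      ≈⟨ +-congˡ (+-cong (eval-pmul f g x) (*-congˡ (eval-derivative-pmul f g x))) ⟩
    a * DG + (F * G + x * (DF * G + F * DG))
      ≈⟨ solve 6 (λ a x F G DF DG → a :* DG :+ (F :* G :+ x :* (DF :* G :+ F :* DG))
                                      := (F :+ x :* DF) :* G :+ (a :+ x :* F) :* DG) ≈-refl a x F G DF DG ⟩
    (F + x * DF) * G + (a + x * F) * DG
      ≈⟨ +-congʳ (*-congʳ (eval-derivative-∷ a f x)) ⟨
    eval 0# (derivative (a ∷ f)) x * G + (a + x * F) * DG ∎
    where
    F = eval 0# f x
    G = eval 0# g x
    DF = eval 0# (derivative f) x
    DG = eval 0# (derivative g) x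

  eval-derivative-AllZero : ∀ {f} x → AllZero f → eval 0# (derivative f) x ≈ 0#
  eval-derivative-AllZero x []                  = ≈-refl
  eval-derivative-AllZero {a ∷ f} x (_ ∷ f≈0) = begin
    eval 0# (derivative (a ∷ f)) x          ≈⟨ eval-derivative-∷ a f x ⟩
    eval 0# f x + x * eval 0# (derivative f) x ≈⟨ +-cong (eval-AllZero x f≈0) (*-congˡ (eval-derivative-AllZero x f≈0)) ⟩
    0# + x * 0#                             ≈⟨ ≈-trans (+-identityˡ _) (zeroʳ x) ⟩
    0#                                      ∎

  eval-derivative-root : ∀ τ ρ a g → eval 0# (derivative ((a ∷ g) ∷ʳ τ)) ρ ≈ eval τ (deflate τ ρ (a ∷ g)) ρ
  eval-derivative-root τ ρ a []      = begin
    τ + ρ * 0#              ≈⟨ +-congˡ (zeroʳ ρ) ⟩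
    τ + 0#                  ≈⟨ +-identityʳ τ ⟩
    τ                       ∎
  eval-derivative-root τ ρ a (b ∷ g) = begin
    eval 0# (derivative (a ∷ ((b ∷ g) ∷ʳ τ))) ρ
      ≈⟨ eval-derivative-∷ a ((b ∷ g) ∷ʳ τ) ρ ⟩
    eval 0# ((b ∷ g) ∷ʳ τ) ρ + ρ * eval 0# (derivative ((b ∷ g) ∷ʳ τ)) ρ
      ≈⟨ +-cong (eval₀-∷ʳ (b ∷ g) τ ρ) (*-congˡ (eval-derivative-root τ ρ b g)) ⟩
    eval τ (b ∷ g) ρ + ρ * eval τ (deflate τ ρ (b ∷ g)) ρ
      ∎

  weighted-cong : ∀ k {f g} → f ≋ g → weighted k f ≋ weighted k g
  weighted-cong k []          = []
  weighted-cong k (b≈ ∷ f≋g) = ×-congʳ k b≈ ∷ weighted-cong (suc k) f≋g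

  derivative-cong : ∀ {f g} → f ≋ g → derivative f ≋ derivative g
  derivative-cong []          = []
  derivative-cong (_ ∷ f≋g) = weighted-cong 1 f≋g

  infix 4 _≃_

  record _≃_ (f g : Poly) : Set (c ⊔ ℓ) where
    constructor ≃-by
    field difference-zero : AllZero (psub f g)

  ≃⇒eval : ∀ {f g} x → f ≃ g → eval 0# f x ≈ eval 0# g x
  ≃⇒eval {f} {g} x (≃-by f-g≈0) = x∙y⁻¹≈ε⇒x≈y _ _ (≈-trans (≈-sym (eval-psub f g x)) (eval-AllZero x f-g≈0))

  ≃⇒eval-derivative : ∀ {f g} x → f ≃ g → eval 0# (derivative f) x ≈ eval 0# (derivative g) x
  ≃⇒eval-derivative {f} {g} x (≃-by f-g≈0) = x∙y⁻¹≈ε⇒x≈y _ _ (begin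
    eval 0# (derivative f) x - eval 0# (derivative g) x
      ≈⟨ +-congˡ (≈-trans (eval-derivative-pscale (- 1#) g x) (-1*x≈-x _)) ⟨
    eval 0# (derivative f) x + eval 0# (derivative (pscale (- 1#) g)) x
      ≈⟨ eval-derivative-padd f _ x ⟨
    eval 0# (derivative (psub f g)) x
      ≈⟨ eval-derivative-AllZero x f-g≈0 ⟩
    0# ∎)


module PolynomialAction {c ℓ : Level} (R : CommutativeRing c ℓ) {n : ℕ} (Γ : Graph n) where

  open RingKit R
  open Vectors R
  open Adjacency R Γ
  open Polynomials R

  act : Carrier → Poly → Vector n → Vector n
  act τ []      v = τ ·ᵥ v
  act τ (a ∷ f) v = a ·ᵥ v +ᵥ A (act τ f v)

  act-cong : ∀ τ f {x y} → x ≈ᵥ y → act τ f x ≈ᵥ act τ f y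
  act-cong τ []      x≈y i = *-congˡ (x≈y i)
  act-cong τ (a ∷ f) x≈y i = +-cong (*-congˡ (x≈y i)) (A-cong (act-cong τ f x≈y) i)

  act-cong-top : ∀ {τ σ} f v → τ ≈ σ → act τ f v ≈ᵥ act σ f v
  act-cong-top []      v τ≈σ i = *-congʳ τ≈σ
  act-cong-top (a ∷ f) v τ≈σ i = +-congˡ (A-cong (act-cong-top f v τ≈σ) i)

  act-+ᵥ : ∀ τ f x y → act τ f (x +ᵥ y) ≈ᵥ act τ f x +ᵥ act τ f y
  act-+ᵥ τ []      x y i = distribˡ τ (x i) (y i)
  act-+ᵥ τ (a ∷ f) x y i = begin
    a * (x i + y i) + A (act τ f (x +ᵥ y)) i            ≈⟨ +-cong (distribˡ a (x i) (y i))
                                                             (≈-trans (A-cong (act-+ᵥ τ f x y) i) (A-+ _ _ i)) ⟩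
    (a * x i + a * y i) + (A (act τ f x) i + A (act τ f y) i)
                                                        ≈⟨ solve 4 (λ p q r s → (p :+ q) :+ (r :+ s) := (p :+ r) :+ (q :+ s))
                                                             ≈-refl _ _ _ _ ⟩
    (a * x i + A (act τ f x) i) + (a * y i + A (act τ f y) i) ∎

  act-·ᵥ : ∀ τ f b x → act τ f (b ·ᵥ x) ≈ᵥ b ·ᵥ act τ f x
  act-·ᵥ τ []      b x i = solve 3 (λ τ b u → τ :* (b :* u) := b :* (τ :* u)) ≈-refl τ b (x i)
  act-·ᵥ τ (a ∷ f) b x i = begin
    a * (b * x i) + A (act τ f (b ·ᵥ x)) i   ≈⟨ +-congˡ (≈-trans (A-cong (act-·ᵥ τ f b x) i) (A-· b _ i)) ⟩
    a * (b * x i) + b * A (act τ f x) i      ≈⟨ solve 4 (λ a b u w → a :* (b :* u) :+ b :* w := b :* (a :* u :+ w))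
                                                  ≈-refl a b (x i) _ ⟩
    b * (a * x i + A (act τ f x) i)          ∎

  act-0ᵥ : ∀ τ f {x} → x ≈ᵥ 0ᵥ → act τ f x ≈ᵥ 0ᵥ
  act-0ᵥ τ []      x≈0 i = ≈-trans (*-congˡ (x≈0 i)) (zeroʳ τ)
  act-0ᵥ τ (a ∷ f) x≈0 i =
    ≈-trans (+-cong (≈-trans (*-congˡ (x≈0 i)) (zeroʳ a)) (A-0 (act-0ᵥ τ f x≈0) i)) (+-identityʳ 0#)

  act-A : ∀ τ f v → A (act τ f v) ≈ᵥ act τ f (A v)
  act-A τ []      v i = A-· τ v i
  act-A τ (a ∷ f) v i = begin
    A (a ·ᵥ v +ᵥ A (act τ f v)) i       ≈⟨ A-+ _ _ i ⟩
    A (a ·ᵥ v) i + A (A (act τ f v)) i  ≈⟨ +-cong (A-· a v i) (A-cong (act-A τ f v) i) ⟩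
    a * A v i + A (act τ f (A v)) i     ∎

  act-comm : ∀ τ f σ g v → act τ f (act σ g v) ≈ᵥ act σ g (act τ f v)
  act-comm τ []      σ g v i = ≈-sym (act-·ᵥ σ g τ v i)
  act-comm τ (a ∷ f) σ g v i = begin
    a * act σ g v i + A (act τ f (act σ g v)) i        ≈⟨ +-congˡ (A-cong (act-comm τ f σ g v) i) ⟩
    a * act σ g v i + A (act σ g (act τ f v)) i        ≈⟨ +-cong (act-·ᵥ σ g a v i) (≈-sym (act-A σ g (act τ f v) i)) ⟨
    act σ g (a ·ᵥ v) i + act σ g (A (act τ f v)) i     ≈⟨ act-+ᵥ σ g _ _ i ⟨
    act σ g (a ·ᵥ v +ᵥ A (act τ f v)) i                ∎

  act-sym : ∀ τ f x y → ⟨ act τ f x , y ⟩ ≈ ⟨ x , act τ f y ⟩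
  act-sym τ []      x y = ≈-trans (⟨⟩-·ˡ τ x y) (≈-sym (⟨⟩-·ʳ τ x y))
  act-sym τ (a ∷ f) x y = begin
    ⟨ a ·ᵥ x +ᵥ A (act τ f x) , y ⟩          ≈⟨ ⟨⟩-+ˡ _ _ y ⟩
    ⟨ a ·ᵥ x , y ⟩ + ⟨ A (act τ f x) , y ⟩   ≈⟨ +-cong (⟨⟩-·ˡ a x y) (A-sym _ y) ⟩
    a * ⟨ x , y ⟩ + ⟨ act τ f x , A y ⟩      ≈⟨ +-congˡ (act-sym τ f x (A y)) ⟩
    a * ⟨ x , y ⟩ + ⟨ x , act τ f (A y) ⟩    ≈⟨ +-cong (⟨⟩-·ʳ a x y) (⟨⟩-cong (λ _ → ≈-refl) (act-A τ f y)) ⟨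
    ⟨ x , a ·ᵥ y ⟩ + ⟨ x , A (act τ f y) ⟩   ≈⟨ ⟨⟩-+ʳ x _ _ ⟨
    ⟨ x , a ·ᵥ y +ᵥ A (act τ f y) ⟩          ∎

  act-eigen : ∀ τ f ρ u → A u ≈ᵥ ρ ·ᵥ u → act τ f u ≈ᵥ eval τ f ρ ·ᵥ u
  act-eigen τ []      ρ u Au≈ρu i = ≈-refl
  act-eigen τ (a ∷ f) ρ u Au≈ρu i = begin
    a * u i + A (act τ f u) i           ≈⟨ +-congˡ (≈-trans (A-cong (act-eigen τ f ρ u Au≈ρu) i) (A-· _ u i)) ⟩
    a * u i + eval τ f ρ * A u i        ≈⟨ +-congˡ (*-congˡ (Au≈ρu i)) ⟩
    a * u i + eval τ f ρ * (ρ * u i)    ≈⟨ solve 4 (λ a F ρ u → a :* u :+ F :* (ρ :* u) := (a :+ ρ :* F) :* u)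
                                             ≈-refl a (eval τ f ρ) ρ (u i) ⟩
    (a + ρ * eval τ f ρ) * u i          ∎

  act-deflate : ∀ τ ρ a f v → let w = act τ (deflate τ ρ (a ∷ f)) v in
                act τ (a ∷ f) v ≈ᵥ (A w +ᵥ (- ρ) ·ᵥ w) +ᵥ eval τ (a ∷ f) ρ ·ᵥ v
  act-deflate τ ρ a []      v i = solve 5 (λ a u τ ρ Aτv → a :* u :+ Aτv := (Aτv :+ (:- ρ) :* (τ :* u)) :+ (a :+ ρ :* τ) :* u)
                                    ≈-refl a (v i) τ ρ (A (τ ·ᵥ v) i)
  act-deflate τ ρ a (b ∷ f) v i = begin
    a * v i + A (act τ (b ∷ f) v) i
      ≈⟨ +-congˡ (A-cong (act-deflate τ ρ b f v) i) ⟩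
    a * v i + A ((A w′ +ᵥ (- ρ) ·ᵥ w′) +ᵥ P ·ᵥ v) i
      ≈⟨ +-congˡ (≈-trans (A-+ _ _ i) (+-cong (≈-trans (A-+ _ _ i) (+-congˡ (A-· (- ρ) w′ i))) (A-· P v i))) ⟩
    a * v i + ((A (A w′) i + (- ρ) * A w′ i) + P * A v i)
      ≈⟨ solve 7 (λ a u ρ P AAw Aw Av → a :* u :+ ((AAw :+ (:- ρ) :* Aw) :+ P :* Av)
                                          := ((P :* Av :+ AAw) :+ (:- ρ) :* (P :* u :+ Aw)) :+ (a :+ ρ :* P) :* u)
           ≈-refl a (v i) ρ P (A (A w′) i) (A w′ i) (A v i) ⟩
    ((P * A v i + A (A w′) i) + (- ρ) * (P * v i + A w′ i)) + (a + ρ * P) * v i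
      ≈⟨ +-congʳ (+-congʳ (≈-trans (A-+ (P ·ᵥ v) (A w′) i) (+-congʳ (A-· P v i)))) ⟨
    (A (P ·ᵥ v +ᵥ A w′) i + (- ρ) * (P * v i + A w′ i)) + (a + ρ * P) * v i
      ∎
    where
    P  = eval τ (b ∷ f) ρ
    w′ = act τ (deflate τ ρ (b ∷ f)) v

  krylov : ∀ h e v → (∀ i → i < length h → ⟨ e , A^ i v ⟩ ≈ 0#) → ⟨ e , act 1# h v ⟩ ≈ ⟨ e , A^ (length h) v ⟩
  krylov []      e v _ = ≈-trans (⟨⟩-·ʳ 1# e v) (*-identityˡ _)
  krylov (c ∷ h) e v orthogonal = begin
    ⟨ e , c ·ᵥ v +ᵥ A (act 1# h v) ⟩         ≈⟨ ⟨⟩-+ʳ e _ _ ⟩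
    ⟨ e , c ·ᵥ v ⟩ + ⟨ e , A (act 1# h v) ⟩  ≈⟨ +-cong (≈-trans (⟨⟩-·ʳ c e v) (≈-trans (*-congˡ (orthogonal 0 (s≤s z≤n))) (zeroʳ c)))
                                                    (≈-sym (A-sym e _)) ⟩
    0# + ⟨ A e , act 1# h v ⟩                ≈⟨ +-identityˡ _ ⟩
    ⟨ A e , act 1# h v ⟩                     ≈⟨ krylov h (A e) v (λ i i<h → ≈-trans (A-sym e _) (orthogonal (suc i) (s≤s i<h))) ⟩
    ⟨ A e , A^ (length h) v ⟩                ≈⟨ A-sym e _ ⟩
    ⟨ e , A^ (suc (length h)) v ⟩            ∎

  act-padd : ∀ f g v → act 0# (padd f g) v ≈ᵥ act 0# f v +ᵥ act 0# g v
  act-padd []      g       v i = ≈-sym (≈-trans (+-congʳ (zeroˡ (v i))) (+-identityˡ _))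
  act-padd (a ∷ f) []      v i = ≈-sym (≈-trans (+-congˡ (zeroˡ (v i))) (+-identityʳ _))
  act-padd (a ∷ f) (b ∷ g) v i = begin
    (a + b) * v i + A (act 0# (padd f g) v) i                 ≈⟨ +-congˡ (≈-trans (A-cong (act-padd f g v) i) (A-+ _ _ i)) ⟩
    (a + b) * v i + (A (act 0# f v) i + A (act 0# g v) i)     ≈⟨ solve 5 (λ a b u p q → (a :+ b) :* u :+ (p :+ q) := (a :* u :+ p) :+ (b :* u :+ q))
                                                                   ≈-refl a b (v i) _ _ ⟩
    (a * v i + A (act 0# f v) i) + (b * v i + A (act 0# g v) i) ∎

  act-padd-≤ : ∀ τ f g v → length g ≤ length f → act τ (padd f g) v ≈ᵥ act τ f v +ᵥ act 0# g v
  act-padd-≤ τ []      []      v _         i = ≈-sym (≈-trans (+-congˡ (zeroˡ (v i))) (+-identityʳ _))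
  act-padd-≤ τ (a ∷ f) []      v _         i = ≈-sym (≈-trans (+-congˡ (zeroˡ (v i))) (+-identityʳ _))
  act-padd-≤ τ (a ∷ f) (b ∷ g) v (s≤s g≤f) i = begin
    (a + b) * v i + A (act τ (padd f g) v) i                  ≈⟨ +-congˡ (≈-trans (A-cong (act-padd-≤ τ f g v g≤f) i) (A-+ _ _ i)) ⟩
    (a + b) * v i + (A (act τ f v) i + A (act 0# g v) i)      ≈⟨ solve 5 (λ a b u p q → (a :+ b) :* u :+ (p :+ q) := (a :* u :+ p) :+ (b :* u :+ q))
                                                                   ≈-refl a b (v i) _ _ ⟩
    (a * v i + A (act τ f v) i) + (b * v i + A (act 0# g v) i) ∎

  act-pscale : ∀ a τ f v → act (a * τ) (pscale a f) v ≈ᵥ a ·ᵥ act τ f v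
  act-pscale a τ []      v i = *-assoc a τ (v i)
  act-pscale a τ (b ∷ f) v i = begin
    a * b * v i + A (act (a * τ) (pscale a f) v) i   ≈⟨ +-congˡ (≈-trans (A-cong (act-pscale a τ f v) i) (A-· a _ i)) ⟩
    a * b * v i + a * A (act τ f v) i                ≈⟨ solve 4 (λ a b u w → a :* b :* u :+ a :* w := a :* (b :* u :+ w))
                                                          ≈-refl a b (v i) _ ⟩
    a * (b * v i + A (act τ f v) i)                  ∎

  act₀-pscale : ∀ a f v → act 0# (pscale a f) v ≈ᵥ a ·ᵥ act 0# f v
  act₀-pscale a f v i = ≈-trans (act-cong-top (pscale a f) v (≈-sym (zeroʳ a)) i) (act-pscale a 0# f v i)

  act-pmul : ∀ f g v → act 0# (pmul f g) v ≈ᵥ act 0# f (act 0# g v)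
  act-pmul []      g v i = ≈-trans (zeroˡ (v i)) (≈-sym (zeroˡ _))
  act-pmul (a ∷ f) g v i = begin
    act 0# (padd (pscale a g) (0# ∷ pmul f g)) v i                   ≈⟨ act-padd (pscale a g) _ v i ⟩
    act 0# (pscale a g) v i + (0# * v i + A (act 0# (pmul f g) v) i) ≈⟨ +-cong (act₀-pscale a g v i)
                                                                          (≈-trans (+-cong (zeroˡ (v i)) (A-cong (act-pmul f g v) i)) (+-identityˡ _)) ⟩
    a * act 0# g v i + A (act 0# f (act 0# g v)) i                   ∎

  act-∷ʳ : ∀ f a v → act 0# (f ∷ʳ a) v ≈ᵥ act a f v
  act-∷ʳ []      a v i = ≈-trans (+-congˡ (A-0 (λ j → zeroˡ (v j)) i)) (+-identityʳ _)
  act-∷ʳ (b ∷ f) a v i = +-congˡ (A-cong (act-∷ʳ f a v) i)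

  act-AllZero : ∀ {f} v → AllZero f → act 0# f v ≈ᵥ 0ᵥ
  act-AllZero v []          i = zeroˡ (v i)
  act-AllZero v (a≈0 ∷ f≈0) i = ≈-trans (+-cong (≈-trans (*-congʳ a≈0) (zeroˡ (v i))) (A-0 (act-AllZero v f≈0) i)) (+-identityʳ 0#)

  ≃⇒act : ∀ {f g} v → f ≃ g → act 0# f v ≈ᵥ act 0# g v
  ≃⇒act {f} {g} v (≃-by f-g≈0) i = x∙y⁻¹≈ε⇒x≈y _ _ (begin
    act 0# f v i - act 0# g v i                        ≈⟨ +-congˡ (≈-trans (act₀-pscale (- 1#) g v i) (-1*x≈-x _)) ⟨
    act 0# f v i + act 0# (pscale (- 1#) g) v i        ≈⟨ act-padd f _ v i ⟨
    act 0# (psub f g) v i                              ≈⟨ act-AllZero v f-g≈0 i ⟩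
    0#                                                 ∎)


module RingHomomorphism {c₁ ℓ₁ c₂ ℓ₂ : Level} (R₁ : CommutativeRing c₁ ℓ₁) (R₂ : CommutativeRing c₂ ℓ₂)
  (φ : CommutativeRing.Carrier R₁ → CommutativeRing.Carrier R₂)
  (isHom : RingMorphisms.IsRingHomomorphism (CommutativeRing.rawRing R₁) (CommutativeRing.rawRing R₂) φ)
  where

  private
    module P₁ = Polynomials R₁
    module V₁ = Vectors R₁
    module R₁ = RingKit R₁
  open RingKit R₂
  open Polynomials R₂
  open Vectors R₂
  open RingMorphisms.IsRingHomomorphism isHom
    using (+-homo; *-homo; -‿homo; 0#-homo; 1#-homo) renaming (⟦⟧-cong to φ-cong)

  map-padd : ∀ f g → map φ (P₁.padd f g) ≋ padd (map φ f) (map φ g)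
  map-padd []      g       = ≋-refl
  map-padd (a ∷ f) []      = ≋-refl
  map-padd (a ∷ f) (b ∷ g) = +-homo a b ∷ map-padd f g

  map-pscale : ∀ a f → map φ (P₁.pscale a f) ≋ pscale (φ a) (map φ f)
  map-pscale a []      = []
  map-pscale a (b ∷ f) = *-homo a b ∷ map-pscale a f

  map-psub : ∀ f g → map φ (P₁.psub f g) ≋ psub (map φ f) (map φ g)
  map-psub f g = ≋-trans (map-padd f _) (padd-cong ≋-refl (≋-trans (map-pscale _ g)
                   (pscale-cong (≈-trans (-‿homo R₁.1#) (-‿cong 1#-homo)) ≋-refl)))

  map-pmul : ∀ f g → map φ (P₁.pmul f g) ≋ pmul (map φ f) (map φ g)
  map-pmul []      g = []
  map-pmul (a ∷ f) g = ≋-trans (map-padd (P₁.pscale a g) _) (padd-cong (map-pscale a g) (0#-homo ∷ map-pmul f g))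

  φ-×ₙ : ∀ k a → φ (k R₁.×ₙ a) ≈ k ×ₙ φ a
  φ-×ₙ zero    a = 0#-homo
  φ-×ₙ (suc k) a = ≈-trans (φ-cong (R₁.1+× k a)) (≈-trans (+-homo a _) (≈-trans (+-congˡ (φ-×ₙ k a)) (≈-sym (1+× k (φ a)))))

  map-weighted : ∀ k f → map φ (P₁.weighted k f) ≋ weighted k (map φ f)
  map-weighted k []      = []
  map-weighted k (b ∷ f) = φ-×ₙ k b ∷ map-weighted (suc k) f

  map-derivative : ∀ f → map φ (P₁.derivative f) ≋ derivative (map φ f)
  map-derivative []      = []
  map-derivative (a ∷ f) = map-weighted 1 f

  map-AllZero : ∀ {f} → P₁.AllZero f → AllZero (map φ f)
  map-AllZero []          = []
  map-AllZero (a≈0 ∷ f≈0) = ≈-trans (φ-cong a≈0) 0#-homo ∷ map-AllZero f≈0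

  map-≃ : ∀ {f g} → f P₁.≃ g → map φ f ≃ map φ g
  map-≃ {f} {g} (P₁.≃-by f-g≈0) = ≃-by (AllZero-resp-≋ (map-psub f g) (map-AllZero f-g≈0))

  map-∷ʳ : ∀ f a → map φ (f ∷ʳ a) ≡ map φ f ∷ʳ φ a
  map-∷ʳ f a = List.map-++ φ f (a ∷ [])

  φ-∑ : ∀ {n} (f : Fin n → R₁.Carrier) → φ (∑ R₁ f) ≈ ∑ R₂ (λ i → φ (f i))
  φ-∑ {zero}  f = 0#-homo
  φ-∑ {suc n} f = ≈-trans (+-homo _ _) (+-congˡ (φ-∑ (λ i → f (suc i))))

  φ-⟨⟩ : ∀ {n} (x y : V₁.Vector n) → φ (V₁.⟨ x , y ⟩) ≈ ⟨ (λ i → φ (x i)) , (λ i → φ (y i)) ⟩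
  φ-⟨⟩ x y = ≈-trans (φ-∑ (λ i → x i R₁.* y i)) (∑-cong (λ i → *-homo (x i) (y i)))

  module OnGraph {n : ℕ} (Γ : Graph n) where

    private
      module A₁ = Adjacency R₁ Γ
      module Act₁ = PolynomialAction R₁ Γ
    open Adjacency R₂ Γ
    open PolynomialAction R₂ Γ

    φᵥ : V₁.Vector n → Vector n
    φᵥ v i = φ (v i)

    φ-A : ∀ v → φᵥ (A₁.A v) ≈ᵥ A (φᵥ v)
    φ-A v i = ≈-trans (φ-∑ (λ j → if adj Γ i j then v j else R₁.0#)) (∑-cong (λ j → φ-entry (adj Γ i j) (v j)))
      where
      φ-entry : ∀ b u → φ (if b then u else R₁.0#) ≈ (if b then φ u else 0#)
      φ-entry true  u = ≈-refl
      φ-entry false u = 0#-homo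

    φ-A^ : ∀ k v → φᵥ (A₁.A^ k v) ≈ᵥ A^ k (φᵥ v)
    φ-A^ zero    v i = ≈-refl
    φ-A^ (suc k) v i = ≈-trans (φ-A (A₁.A^ k v) i) (A-cong (φ-A^ k v) i)

    φ-act : ∀ τ f v → φᵥ (Act₁.act τ f v) ≈ᵥ act (φ τ) (map φ f) (φᵥ v)
    φ-act τ []      v i = *-homo τ (v i)
    φ-act τ (a ∷ f) v i = ≈-trans (+-homo _ _) (+-cong (*-homo a (v i)) (≈-trans (φ-A _ i) (A-cong (φ-act τ f v) i)))


ℚ-ring : CommutativeRing 0ℓ 0ℓ
ℚ-ring = ℚ.+-*-commutativeRing


module Rationals where

  open Vectors ℚ-ring
  open RingKit ℚ-ring using (solve; _:=_; _:+_; _:*_; :-_; _:-_; con; field⇒domain)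
  open ≡.≡-Reasoning

  -- A total inverse with 0ℚ ⁻¹ = 0ℚ, so that the Lanczos coefficients are defined
  -- even at a vanishing pivot.
  _⁻¹ : ℚ → ℚ
  p ⁻¹ with p ℚ.≟ 0ℚ
  ... | yes _   = 0ℚ
  ... | no  p≢0 = ℚ.1/_ p {{ℚ.≢-nonZero p≢0}}

  *-inverseʳ : ∀ p → p ≢ 0ℚ → p ℚ.* p ⁻¹ ≡ 1ℚ
  *-inverseʳ p p≢0 with p ℚ.≟ 0ℚ
  ... | yes p≡0 = ⊥-elim (p≢0 p≡0)
  ... | no  p≢0 = ℚ.*-inverseʳ p {{ℚ.≢-nonZero p≢0}}

  *-inverse-cancel : ∀ x {y} → y ≢ 0ℚ → x ℚ.* y ⁻¹ ℚ.* y ≡ x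
  *-inverse-cancel x {y} y≢0 = begin
    x ℚ.* y ⁻¹ ℚ.* y    ≡⟨ ℚ.*-assoc x (y ⁻¹) y ⟩
    x ℚ.* (y ⁻¹ ℚ.* y)  ≡⟨ ≡.cong (x ℚ.*_) (≡.trans (ℚ.*-comm (y ⁻¹) y) (*-inverseʳ y y≢0)) ⟩
    x ℚ.* 1ℚ            ≡⟨ ℚ.*-identityʳ x ⟩
    x                   ∎

  ℚ-isField : IsField ℚ-ring
  ℚ-isField = (λ ()) , λ p p≢0 → p ⁻¹ , *-inverseʳ p p≢0

  point : ℕ → ℚ
  point i = mkℚ (+ i) 0 (Coprime.sym (Coprime.1-coprimeTo i))

  point-injective : ∀ {i j} → point i ≡ point j → i ≡ j
  point-injective ≡.refl = ≡.refl

  square-nonneg : ∀ p → 0ℚ ℚ.≤ p ℚ.* p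
  square-nonneg p@(mkℚ (+ _)    _ _) = ℚ.nonNegative⁻¹ _ {{ℚ.nonNeg*nonNeg⇒nonNeg p p}}
  square-nonneg p@(mkℚ -[1+ _ ] _ _) = ℚ.nonNegative⁻¹ _ {{ℚ.nonPos*nonPos⇒nonPos p p}}

  private
    +-nonneg-zeroˡ : ∀ {p q} → 0ℚ ℚ.≤ p → 0ℚ ℚ.≤ q → p ℚ.+ q ≡ 0ℚ → p ≡ 0ℚ
    +-nonneg-zeroˡ {p} {q} 0≤p 0≤q p+q≡0 =
      ℚ.≤-antisym (≡.subst₂ ℚ._≤_ (ℚ.+-identityʳ p) p+q≡0 (ℚ.+-monoʳ-≤ p 0≤q)) 0≤p

    ∑-nonneg : ∀ {n} (f : Vector n) → (∀ i → 0ℚ ℚ.≤ f i) → 0ℚ ℚ.≤ ∑ ℚ-ring f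
    ∑-nonneg {zero}  f 0≤f = ℚ.≤-refl
    ∑-nonneg {suc n} f 0≤f = ≡.subst (ℚ._≤ ∑ ℚ-ring f) (ℚ.+-identityʳ 0ℚ)
                               (ℚ.+-mono-≤ (0≤f zero) (∑-nonneg (λ i → f (suc i)) (λ i → 0≤f (suc i))))

    ∑-nonneg-zero : ∀ {n} (f : Vector n) → (∀ i → 0ℚ ℚ.≤ f i) → ∑ ℚ-ring f ≡ 0ℚ → f ≈ᵥ 0ᵥ
    ∑-nonneg-zero {suc n} f 0≤f ∑≡0 zero = +-nonneg-zeroˡ (0≤f zero) (∑-nonneg _ (λ i → 0≤f (suc i))) ∑≡0
    ∑-nonneg-zero {suc n} f 0≤f ∑≡0 (suc i) =
      ∑-nonneg-zero (λ i → f (suc i)) (λ i → 0≤f (suc i))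
        (+-nonneg-zeroˡ (∑-nonneg _ (λ i → 0≤f (suc i))) (0≤f zero)
          (≡.trans (ℚ.+-comm _ (f zero)) ∑≡0)) i

  ⟨⟩-nonneg : ∀ {n} (v : Vector n) → 0ℚ ℚ.≤ ⟨ v , v ⟩
  ⟨⟩-nonneg v = ∑-nonneg _ (λ i → square-nonneg (v i))

  ⟨⟩-definite : ∀ {n} (v : Vector n) → ⟨ v , v ⟩ ≡ 0ℚ → v ≈ᵥ 0ᵥ
  ⟨⟩-definite v ⟨v,v⟩≡0 i with v i ℚ.≟ 0ℚ
  ... | yes vᵢ≡0 = vᵢ≡0
  ... | no  vᵢ≢0 = field⇒domain ℚ-isField (v i) (v i)
                     (∑-nonneg-zero _ (λ i → square-nonneg (v i)) ⟨v,v⟩≡0 i) vᵢ≢0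

  Orthogonal : ∀ {n} → List (Vector n) → Set
  Orthogonal = AllPairs (λ e e′ → ⟨ e , e′ ⟩ ≡ 0ℚ)

  private
    besselSum : ∀ {n} → List (Vector n) → Vector n → ℚ
    besselSum []      x = 0ℚ
    besselSum (e ∷ E) x = ⟨ x , e ⟩ ℚ.* ⟨ x , e ⟩ ℚ.* ⟨ e , e ⟩ ⁻¹ ℚ.+ besselSum E x

    besselSum-cong : ∀ {n} (E : List (Vector n)) x y → All (λ e → ⟨ x , e ⟩ ≡ ⟨ y , e ⟩) E → besselSum E x ≡ besselSum E y
    besselSum-cong []      x y []         = ≡.refl
    besselSum-cong (e ∷ E) x y (xe≡ye ∷ ≡s) =
      ≡.cong₂ ℚ._+_ (≡.cong (λ z → z ℚ.* z ℚ.* ⟨ e , e ⟩ ⁻¹) xe≡ye) (besselSum-cong E x y ≡s)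

    project : ∀ {n} → Vector n → Vector n → Vector n
    project x e = x +ᵥ (ℚ.- (⟨ x , e ⟩ ℚ.* ⟨ e , e ⟩ ⁻¹)) ·ᵥ e

    ⟨project,_⟩ : ∀ {n} {x e : Vector n} e′ → ⟨ e , e′ ⟩ ≡ 0ℚ → ⟨ project x e , e′ ⟩ ≡ ⟨ x , e′ ⟩
    ⟨project,_⟩ {x = x} {e} e′ e⊥e′ = begin
      ⟨ project x e , e′ ⟩                ≡⟨ ⟨⟩-+ˡ x _ e′ ⟩
      ⟨ x , e′ ⟩ ℚ.+ ⟨ (ℚ.- c) ·ᵥ e , e′ ⟩ ≡⟨ ≡.cong (⟨ x , e′ ⟩ ℚ.+_) (≡.trans (⟨⟩-·ˡ (ℚ.- c) e e′)
                                                 (≡.trans (≡.cong ((ℚ.- c) ℚ.*_) e⊥e′) (ℚ.*-zeroʳ (ℚ.- c)))) ⟩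
      ⟨ x , e′ ⟩ ℚ.+ 0ℚ                   ≡⟨ ℚ.+-identityʳ _ ⟩
      ⟨ x , e′ ⟩                          ∎
      where c = ⟨ x , e ⟩ ℚ.* ⟨ e , e ⟩ ⁻¹

    ⟨project,project⟩ : ∀ {n} (x e : Vector n) → ⟨ e , e ⟩ ≢ 0ℚ →
                        ⟨ project x e , project x e ⟩ ≡ ⟨ x , x ⟩ ℚ.- ⟨ x , e ⟩ ℚ.* ⟨ x , e ⟩ ℚ.* ⟨ e , e ⟩ ⁻¹
    ⟨project,project⟩ x e e≢0 = begin
      ⟨ x′ , x′ ⟩
        ≡⟨ ⟨⟩-+ˡ x _ x′ ⟩
      ⟨ x , x′ ⟩ ℚ.+ ⟨ (ℚ.- c) ·ᵥ e , x′ ⟩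
        ≡⟨ ≡.cong₂ ℚ._+_ (⟨⟩-+ʳ x x _) (⟨⟩-·ˡ (ℚ.- c) e x′) ⟩
      (X ℚ.+ ⟨ x , (ℚ.- c) ·ᵥ e ⟩) ℚ.+ (ℚ.- c) ℚ.* ⟨ e , x′ ⟩
        ≡⟨ ≡.cong₂ (λ u v → (X ℚ.+ u) ℚ.+ (ℚ.- c) ℚ.* v) (⟨⟩-·ʳ (ℚ.- c) x e)
             (≡.trans (⟨⟩-+ʳ e x _) (≡.cong₂ ℚ._+_ (⟨⟩-comm e x) (⟨⟩-·ʳ (ℚ.- c) e e))) ⟩
      (X ℚ.+ (ℚ.- c) ℚ.* Y) ℚ.+ (ℚ.- c) ℚ.* (Y ℚ.+ (ℚ.- c) ℚ.* H)
        ≡⟨ solve 4 (λ X Y H H⁻¹ → (X :+ (:- (Y :* H⁻¹)) :* Y) :+ (:- (Y :* H⁻¹)) :* (Y :+ (:- (Y :* H⁻¹)) :* H)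
                                   := (X :- Y :* Y :* H⁻¹) :+ Y :* Y :* H⁻¹ :* (H :* H⁻¹ :- con (+ 1)))
             ≡.refl X Y H (H ⁻¹) ⟩
      (X ℚ.- Y ℚ.* Y ℚ.* H ⁻¹) ℚ.+ Y ℚ.* Y ℚ.* H ⁻¹ ℚ.* (H ℚ.* H ⁻¹ ℚ.- 1ℚ)
        ≡⟨ ≡.cong (λ u → (X ℚ.- Y ℚ.* Y ℚ.* H ⁻¹) ℚ.+ Y ℚ.* Y ℚ.* H ⁻¹ ℚ.* (u ℚ.- 1ℚ)) (*-inverseʳ H e≢0) ⟩
      (X ℚ.- Y ℚ.* Y ℚ.* H ⁻¹) ℚ.+ Y ℚ.* Y ℚ.* H ⁻¹ ℚ.* (1ℚ ℚ.- 1ℚ)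
        ≡⟨ solve 3 (λ X Y H⁻¹ → (X :- Y :* Y :* H⁻¹) :+ Y :* Y :* H⁻¹ :* (con (+ 1) :- con (+ 1)) := X :- Y :* Y :* H⁻¹)
             ≡.refl X Y (H ⁻¹) ⟩
      X ℚ.- Y ℚ.* Y ℚ.* H ⁻¹
        ∎
      where
      X = ⟨ x , x ⟩
      Y = ⟨ x , e ⟩
      H = ⟨ e , e ⟩
      c = Y ℚ.* H ⁻¹
      x′ = project x e

    bessel : ∀ {n} (E : List (Vector n)) x → Orthogonal E → All (λ e → ⟨ e , e ⟩ ≢ 0ℚ) E → besselSum E x ℚ.≤ ⟨ x , x ⟩
    bessel []      x _            _            = ⟨⟩-nonneg x
    bessel (e ∷ E) x (e⊥E ∷ orth) (e≢0 ∷ E≢0) =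
      ≡.subst (besselSum (e ∷ E) x ℚ.≤_) total (ℚ.+-monoʳ-≤ (Y ℚ.* Y ℚ.* ⟨ e , e ⟩ ⁻¹) IH)
      where
      X = ⟨ x , x ⟩
      Y = ⟨ x , e ⟩
      IH : besselSum E x ℚ.≤ X ℚ.- Y ℚ.* Y ℚ.* ⟨ e , e ⟩ ⁻¹
      IH = ≡.subst₂ ℚ._≤_ (besselSum-cong E (project x e) x (All.map (λ {e′} → ⟨project,_⟩ {x = x} {e = e} e′) e⊥E))
             (⟨project,project⟩ x e e≢0) (bessel E (project x e) orth E≢0)
      total : Y ℚ.* Y ℚ.* ⟨ e , e ⟩ ⁻¹ ℚ.+ (X ℚ.- Y ℚ.* Y ℚ.* ⟨ e , e ⟩ ⁻¹) ≡ X
      total = solve 3 (λ X Y H⁻¹ → Y :* Y :* H⁻¹ :+ (X :- Y :* Y :* H⁻¹) := X) ≡.refl X Y (⟨ e , e ⟩ ⁻¹)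

    unit : ∀ {n} → Fin n → Vector n
    unit zero    zero    = 1ℚ
    unit zero    (suc j) = 0ℚ
    unit (suc i) zero    = 0ℚ
    unit (suc i) (suc j) = unit i j

  private
    ∑-zeroˡ : ∀ {n} (f : Vector n) → ∑ ℚ-ring (λ j → 0ℚ ℚ.* f j) ≡ 0ℚ
    ∑-zeroˡ f = ∑-0 (λ j → ℚ.*-zeroˡ (f j))

    ⟨unit,_⟩ : ∀ {n} (i : Fin n) (e : Vector n) → ⟨ unit i , e ⟩ ≡ e i
    ⟨unit,_⟩ zero    e = ≡.trans (≡.cong₂ ℚ._+_ (ℚ.*-identityˡ (e zero)) (∑-zeroˡ (λ j → e (suc j)))) (ℚ.+-identityʳ _)
    ⟨unit,_⟩ (suc i) e = ≡.trans (≡.cong₂ ℚ._+_ (ℚ.*-zeroˡ (e zero)) (⟨unit,_⟩ i (λ j → e (suc j)))) (ℚ.+-identityˡ _)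

    ∑-besselSum-unit : ∀ {n} (E : List (Vector n)) → All (λ e → ⟨ e , e ⟩ ≢ 0ℚ) E →
                       ∑ ℚ-ring (λ i → besselSum E (unit i)) ≡ natCast ℚ-ring (length E)
    ∑-besselSum-unit {n} []      []          = ∑-0 {n} (λ _ → ≡.refl)
    ∑-besselSum-unit {n} (e ∷ E) (e≢0 ∷ E≢0) = begin
      ∑ ℚ-ring (λ i → ⟨ unit i , e ⟩ ℚ.* ⟨ unit i , e ⟩ ℚ.* ⟨ e , e ⟩ ⁻¹ ℚ.+ besselSum E (unit i))
        ≡⟨ ∑-+ (λ i → ⟨ unit i , e ⟩ ℚ.* ⟨ unit i , e ⟩ ℚ.* ⟨ e , e ⟩ ⁻¹) (λ i → besselSum E (unit i)) ⟩
      ∑ ℚ-ring (λ i → ⟨ unit i , e ⟩ ℚ.* ⟨ unit i , e ⟩ ℚ.* ⟨ e , e ⟩ ⁻¹) ℚ.+ ∑ ℚ-ring (λ i → besselSum E (unit i))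
        ≡⟨ ≡.cong₂ ℚ._+_ squares (∑-besselSum-unit E E≢0) ⟩
      1ℚ ℚ.+ natCast ℚ-ring (length E)
        ∎
      where
      squares : ∑ ℚ-ring (λ i → ⟨ unit i , e ⟩ ℚ.* ⟨ unit i , e ⟩ ℚ.* ⟨ e , e ⟩ ⁻¹) ≡ 1ℚ
      squares = begin
        ∑ ℚ-ring (λ i → ⟨ unit i , e ⟩ ℚ.* ⟨ unit i , e ⟩ ℚ.* ⟨ e , e ⟩ ⁻¹)
          ≡⟨ ∑-cong (λ i → ≡.trans (≡.cong (λ z → z ℚ.* z ℚ.* ⟨ e , e ⟩ ⁻¹) (⟨unit,_⟩ i e)) (ℚ.*-comm (e i ℚ.* e i) (⟨ e , e ⟩ ⁻¹))) ⟩
        ∑ ℚ-ring (λ i → ⟨ e , e ⟩ ⁻¹ ℚ.* (e i ℚ.* e i))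
          ≡⟨ ∑-*ˡ (⟨ e , e ⟩ ⁻¹) (λ i → e i ℚ.* e i) ⟩
        ⟨ e , e ⟩ ⁻¹ ℚ.* ⟨ e , e ⟩
          ≡⟨ ≡.trans (ℚ.*-comm (⟨ e , e ⟩ ⁻¹) ⟨ e , e ⟩) (*-inverseʳ _ e≢0) ⟩
        1ℚ ∎

    ∑-unit-norms : ∀ n → ∑ ℚ-ring (λ (i : Fin n) → ⟨ unit i , unit i ⟩) ≡ natCast ℚ-ring n
    ∑-unit-norms n = ≡.trans (∑-cong {n} (λ i → ≡.trans (⟨unit,_⟩ i (unit i)) (unit-diag i))) (ones n)
      where
      unit-diag : ∀ {m} (i : Fin m) → unit i i ≡ 1ℚ
      unit-diag zero    = ≡.refl
      unit-diag (suc i) = unit-diag i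
      ones : ∀ m → ∑ ℚ-ring (λ (_ : Fin m) → 1ℚ) ≡ natCast ℚ-ring m
      ones zero    = ≡.refl
      ones (suc m) = ≡.cong (1ℚ ℚ.+_) (ones m)

    natCast-nonneg : ∀ k → 0ℚ ℚ.≤ natCast ℚ-ring k
    natCast-nonneg zero    = ℚ.≤-refl
    natCast-nonneg (suc k) = ≡.subst (ℚ._≤ natCast ℚ-ring (suc k)) (ℚ.+-identityʳ 0ℚ)
                               (ℚ.+-mono-≤ (ℚ.<⇒≤ (ℚ.positive⁻¹ 1ℚ)) (natCast-nonneg k))

    natCast-mono : ∀ {a b} → a ℕ.≤ b → natCast ℚ-ring a ℚ.≤ natCast ℚ-ring b
    natCast-mono {b = b} ℕ.z≤n       = natCast-nonneg b
    natCast-mono         (ℕ.s≤s a≤b) = ℚ.+-monoʳ-≤ 1ℚ (natCast-mono a≤b)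

    natCast-reflect : ∀ a b → natCast ℚ-ring a ℚ.≤ natCast ℚ-ring b → a ℕ.≤ b
    natCast-reflect a b a≤b with a ℕ.≤? b
    ... | yes a≤b′ = a≤b′
    ... | no  a≰b  = ⊥-elim (ℚ.<-irrefl ≡.refl (ℚ.<-≤-trans b<1+b (ℚ.≤-trans (natCast-mono (ℕ.≰⇒> a≰b)) a≤b)))
      where
      b<1+b : natCast ℚ-ring b ℚ.< natCast ℚ-ring (suc b)
      b<1+b = ≡.subst (ℚ._< natCast ℚ-ring (suc b)) (ℚ.+-identityˡ _) (ℚ.+-mono-<-≤ (ℚ.positive⁻¹ 1ℚ) (ℚ.≤-refl {natCast ℚ-ring b}))

  orthogonal-length-≤ : ∀ {n} (E : List (Vector n)) → Orthogonal E → All (λ e → ⟨ e , e ⟩ ≢ 0ℚ) E → length E ℕ.≤ n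
  orthogonal-length-≤ {n} E orth E≢0 =
    natCast-reflect (length E) n (≡.subst₂ ℚ._≤_ (∑-besselSum-unit E E≢0) (∑-unit-norms n)
      (∑-mono (λ i → bessel E (unit i) orth E≢0)))
    where
    ∑-mono : ∀ {m} {f g : Vector m} → (∀ i → f i ℚ.≤ g i) → ∑ ℚ-ring f ℚ.≤ ∑ ℚ-ring g
    ∑-mono {zero}  f≤g = ℚ.≤-refl
    ∑-mono {suc m} f≤g = ℚ.+-mono-≤ (f≤g zero) (∑-mono (λ i → f≤g (suc i)))


module RationalPolynomials where

  open Polynomials ℚ-ring
  open RingKit ℚ-ring using (field⇒domain; x≈y⇒x∙y⁻¹≈ε)
  open Rationals using (ℚ-isField; point; point-injective)

  ≃-from-pointwise : ∀ f g → (∀ x → eval 0ℚ f x ≡ eval 0ℚ g x) → f ≃ g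
  ≃-from-pointwise f g f≗g = ≃-by (vanishing-everywhere⇒zero (field⇒domain ℚ-isField) point point-injective (psub f g)
    (λ x → ≡.trans (eval-psub f g x) (x≈y⇒x∙y⁻¹≈ε (f≗g x))))


module Lanczos {n : ℕ} (Γ : Graph n) where

  open RingKit ℚ-ring using (solve; _:=_; _:+_; _:*_; :-_; _:-_; con; -1*x≈-x)
  open Vectors ℚ-ring
  open Adjacency ℚ-ring Γ
  open Polynomials ℚ-ring
  open PolynomialAction ℚ-ring Γ
  open Rationals
  open ≡.≡-Reasoning

  j : Vector n
  j _ = 1ℚ

  moment : ℚ → Poly → ℕ → ℚ
  moment τ f i = ⟨ act τ f j , A^ i j ⟩

  -- The recurrence x·p − a·p − b·q, for p monic (given by its lower coefficients).
  next : ℚ → ℚ → Poly → Poly → Poly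
  next a b p q = psub (0ℚ ∷ p) (padd (pscale a (p ∷ʳ 1ℚ)) (pscale b q))

  private
    length-subtrahend : ∀ a b p q → length q ≤ suc (length p) →
                        length (pscale (ℚ.- 1ℚ) (padd (pscale a (p ∷ʳ 1ℚ)) (pscale b q))) ≡ suc (length p)
    length-subtrahend a b p q q≤p = begin
      length (pscale (ℚ.- 1ℚ) (padd (pscale a (p ∷ʳ 1ℚ)) (pscale b q)))  ≡⟨ List.length-map _ (padd (pscale a (p ∷ʳ 1ℚ)) (pscale b q)) ⟩
      length (padd (pscale a (p ∷ʳ 1ℚ)) (pscale b q))                    ≡⟨ length-padd-≤ (pscale a (p ∷ʳ 1ℚ)) (pscale b q)
                                                                              (≡.subst₂ _≤_ (≡.sym (List.length-map _ q)) (≡.sym ap) q≤p) ⟩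
      length (pscale a (p ∷ʳ 1ℚ))                                        ≡⟨ ap ⟩
      suc (length p)                                                     ∎
      where
      ap : length (pscale a (p ∷ʳ 1ℚ)) ≡ suc (length p)
      ap = ≡.trans (List.length-map _ (p ∷ʳ 1ℚ)) (length-∷ʳ p 1ℚ)

  length-next : ∀ a b p q → length q ≤ suc (length p) → length (next a b p q) ≡ suc (length p)
  length-next a b p q q≤p = length-padd-≤ (0ℚ ∷ p) (pscale (ℚ.- 1ℚ) (padd (pscale a (p ∷ʳ 1ℚ)) (pscale b q)))
                              (ℕ.≤-reflexive (length-subtrahend a b p q q≤p))

  moment-next : ∀ a b p q i → length q ≤ suc (length p) →
                moment 1ℚ (next a b p q) i ≡ moment 1ℚ p (suc i) ℚ.- (a ℚ.* moment 1ℚ p i ℚ.+ b ℚ.* moment 0ℚ q i)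
  moment-next a b p q i q≤p = begin
    ⟨ act 1ℚ (next a b p q) j , A^ i j ⟩
      ≡⟨ ⟨⟩-cong act-next (λ _ → ≡.refl) ⟩
    ⟨ A e +ᵥ (ℚ.- 1ℚ) ·ᵥ (a ·ᵥ e +ᵥ b ·ᵥ e′) , A^ i j ⟩
      ≡⟨ ⟨⟩-+ˡ (A e) ((ℚ.- 1ℚ) ·ᵥ (a ·ᵥ e +ᵥ b ·ᵥ e′)) (A^ i j) ⟩
    ⟨ A e , A^ i j ⟩ ℚ.+ ⟨ (ℚ.- 1ℚ) ·ᵥ (a ·ᵥ e +ᵥ b ·ᵥ e′) , A^ i j ⟩
      ≡⟨ ≡.cong₂ ℚ._+_ (A-sym e (A^ i j)) (≡.trans (⟨⟩-·ˡ (ℚ.- 1ℚ) (a ·ᵥ e +ᵥ b ·ᵥ e′) (A^ i j))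
           (≡.cong ((ℚ.- 1ℚ) ℚ.*_) (≡.trans (⟨⟩-+ˡ (a ·ᵥ e) (b ·ᵥ e′) (A^ i j))
             (≡.cong₂ ℚ._+_ (⟨⟩-·ˡ a e (A^ i j)) (⟨⟩-·ˡ b e′ (A^ i j)))))) ⟩
    moment 1ℚ p (suc i) ℚ.+ (ℚ.- 1ℚ) ℚ.* (a ℚ.* moment 1ℚ p i ℚ.+ b ℚ.* moment 0ℚ q i)
      ≡⟨ ≡.cong (moment 1ℚ p (suc i) ℚ.+_) (-1*x≈-x _) ⟩
    moment 1ℚ p (suc i) ℚ.- (a ℚ.* moment 1ℚ p i ℚ.+ b ℚ.* moment 0ℚ q i)
      ∎
    where
    e  = act 1ℚ p j
    e′ = act 0ℚ q j
    X  = padd (pscale a (p ∷ʳ 1ℚ)) (pscale b q)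
    act-next : act 1ℚ (next a b p q) j ≈ᵥ A e +ᵥ (ℚ.- 1ℚ) ·ᵥ (a ·ᵥ e +ᵥ b ·ᵥ e′)
    act-next k = begin
      act 1ℚ (next a b p q) j k
        ≡⟨ act-padd-≤ 1ℚ (0ℚ ∷ p) (pscale (ℚ.- 1ℚ) X) j (ℕ.≤-reflexive (length-subtrahend a b p q q≤p)) k ⟩
      (0ℚ ℚ.* 1ℚ ℚ.+ A e k) ℚ.+ act 0ℚ (pscale (ℚ.- 1ℚ) X) j k
        ≡⟨ ≡.cong₂ ℚ._+_ (ℚ.+-identityˡ (A e k)) (act₀-pscale (ℚ.- 1ℚ) X j k) ⟩
      A e k ℚ.+ (ℚ.- 1ℚ) ℚ.* act 0ℚ X j k
        ≡⟨ ≡.cong (λ z → A e k ℚ.+ (ℚ.- 1ℚ) ℚ.* z) (≡.trans (act-padd (pscale a (p ∷ʳ 1ℚ)) (pscale b q) j k)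
             (≡.cong₂ ℚ._+_ (≡.trans (act₀-pscale a (p ∷ʳ 1ℚ) j k) (≡.cong (a ℚ.*_) (act-∷ʳ p 1ℚ j k)))
                            (act₀-pscale b q j k))) ⟩
      A e k ℚ.+ (ℚ.- 1ℚ) ℚ.* (a ℚ.* e k ℚ.+ b ℚ.* e′ k)
        ∎

  next-orthogonal : ∀ k a b p q → length q ≤ suc (length p) →
    (∀ i → i < k → moment 1ℚ p i ≡ 0ℚ) →
    (∀ i → suc i < k → moment 0ℚ q i ≡ 0ℚ) →
    (∀ i → suc i ≡ k → moment 1ℚ p k ≡ b ℚ.* moment 0ℚ q i) →
    moment 1ℚ p (suc k) ≡ a ℚ.* moment 1ℚ p k ℚ.+ b ℚ.* moment 0ℚ q k →
    ∀ i → i < suc k → moment 1ℚ (next a b p q) i ≡ 0ℚ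
  next-orthogonal k a b p q q≤p p⊥ q⊥ b-eq a-eq i i<1+k
    with ℕ.m<1+n⇒m<n∨m≡n i<1+k
  ... | inj₂ ≡.refl = ≡.trans (moment-next a b p q i q≤p)
                        (≡.trans (≡.cong (ℚ._- (a ℚ.* moment 1ℚ p k ℚ.+ b ℚ.* moment 0ℚ q k)) a-eq)
                                 (ℚ.+-inverseʳ (a ℚ.* moment 1ℚ p k ℚ.+ b ℚ.* moment 0ℚ q k)))
  ... | inj₁ i<k with ℕ.m≤n⇒m<n∨m≡n i<k
  ...   | inj₁ 1+i<k = begin
    moment 1ℚ (next a b p q) i                                        ≡⟨ moment-next a b p q i q≤p ⟩
    moment 1ℚ p (suc i) ℚ.- (a ℚ.* moment 1ℚ p i ℚ.+ b ℚ.* moment 0ℚ q i)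
                                                                      ≡⟨ ≡.cong₂ (λ u v → u ℚ.- (a ℚ.* v ℚ.+ b ℚ.* moment 0ℚ q i))
                                                                           (p⊥ (suc i) 1+i<k) (p⊥ i i<k) ⟩
    0ℚ ℚ.- (a ℚ.* 0ℚ ℚ.+ b ℚ.* moment 0ℚ q i)                          ≡⟨ ≡.cong (λ v → 0ℚ ℚ.- (a ℚ.* 0ℚ ℚ.+ b ℚ.* v)) (q⊥ i 1+i<k) ⟩
    0ℚ ℚ.- (a ℚ.* 0ℚ ℚ.+ b ℚ.* 0ℚ)
      ≡⟨ solve 2 (λ a b → con (+ 0) :- (a :* con (+ 0) :+ b :* con (+ 0)) := con (+ 0))
                                                                           ≡.refl a b ⟩
    0ℚ                                                                ∎
  ...   | inj₂ ≡.refl = begin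
    moment 1ℚ (next a b p q) i                                        ≡⟨ moment-next a b p q i q≤p ⟩
    moment 1ℚ p (suc i) ℚ.- (a ℚ.* moment 1ℚ p i ℚ.+ b ℚ.* moment 0ℚ q i)
                                                                      ≡⟨ ≡.cong₂ (λ u v → u ℚ.- (a ℚ.* v ℚ.+ b ℚ.* moment 0ℚ q i))
                                                                           (b-eq i ≡.refl) (p⊥ i i<k) ⟩
    b ℚ.* moment 0ℚ q i ℚ.- (a ℚ.* 0ℚ ℚ.+ b ℚ.* moment 0ℚ q i)         ≡⟨ solve 3 (λ a b m → b :* m :- (a :* con (+ 0) :+ b :* m) := con (+ 0))
                                                                           ≡.refl a b (moment 0ℚ q i) ⟩
    0ℚ                                                                ∎

  -- β and α make the next vector orthogonal to A^(k-1) j and A^k j; orthogonality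
  -- to the lower Krylov vectors is inherited (next-orthogonal).
  private
    β : ℕ → Poly → Poly → ℚ
    β k q p = moment 1ℚ p k ℚ.* moment 0ℚ q (ℕ.pred k) ⁻¹

    α : ℕ → Poly → Poly → ℚ
    α k q p = (moment 1ℚ p (suc k) ℚ.- β k q p ℚ.* moment 0ℚ q k) ℚ.* moment 1ℚ p k ⁻¹

    lanczos : ℕ → Poly × Poly
    lanczos zero    = [] , []
    lanczos (suc k) = p ∷ʳ 1ℚ , next (α k q p) (β k q p) p q
      where
      q = proj₁ (lanczos k)
      p = proj₂ (lanczos k)

    previous : ℕ → Poly
    previous k = proj₁ (lanczos k)

  basis : ℕ → Poly
  basis k = proj₂ (lanczos k)

  length-basis : ∀ k → length (basis k) ≡ k

  private
    length-previous : ∀ k → length (previous k) ≡ k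
    length-previous zero    = ≡.refl
    length-previous (suc k) = ≡.trans (length-∷ʳ (basis k) 1ℚ) (≡.cong suc (length-basis k))

    previous≤basis : ∀ k → length (previous k) ≤ suc (length (basis k))
    previous≤basis k = ≡.subst₂ _≤_ (≡.sym (length-previous k)) (≡.cong suc (≡.sym (length-basis k))) (ℕ.n≤1+n k)

  length-basis zero    = ≡.refl
  length-basis (suc k) =
    ≡.trans (length-next (α k q p) (β k q p) p q (previous≤basis k)) (≡.cong suc (length-basis k))
    where
    q = previous k
    p = basis k

  e : ℕ → Vector n
  e k = act 1ℚ (basis k) j

  -- Once the earlier pivots are nonzero, pivot k = ⟨ e k , e k ⟩ (see ⟨e,e⟩).
  pivot : ℕ → ℚ
  pivot k = moment 1ℚ (basis k) k

  Nondegenerate : ℕ → Set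
  Nondegenerate k = ∀ i → i < k → pivot i ≢ 0ℚ

  private
    moment-previous : ∀ k i → moment 0ℚ (previous (suc k)) i ≡ moment 1ℚ (basis k) i
    moment-previous k i = ⟨⟩-cong (act-∷ʳ (basis k) 1ℚ j) (λ _ → ≡.refl)

    nondegenerate-pred : ∀ {k} → Nondegenerate (suc k) → Nondegenerate k
    nondegenerate-pred nd i i<k = nd i (ℕ.m≤n⇒m≤1+n i<k)

  basis-orthogonal : ∀ k → Nondegenerate k → ∀ i → i < k → moment 1ℚ (basis k) i ≡ 0ℚ
  previous-orthogonal : ∀ k → Nondegenerate k → ∀ i → suc i < k → moment 0ℚ (previous k) i ≡ 0ℚ

  previous-orthogonal zero    _  i ()
  previous-orthogonal (suc k) nd i (s≤s i<k) =
    ≡.trans (moment-previous k i) (basis-orthogonal k (nondegenerate-pred nd) i i<k)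

  basis-orthogonal zero    _  i ()
  basis-orthogonal (suc k) nd =
    next-orthogonal k (α k q p) (β k q p) p q (previous≤basis k)
      (basis-orthogonal k (nondegenerate-pred nd)) (previous-orthogonal k (nondegenerate-pred nd)) b-eq a-eq
    where
    q = previous k
    p = basis k
    b-eq : ∀ i → suc i ≡ k → moment 1ℚ p k ≡ β k q p ℚ.* moment 0ℚ q i
    b-eq i ≡.refl = ≡.sym (*-inverse-cancel (moment 1ℚ p (suc i))
                      (λ Mq≡0 → nd i (ℕ.m≤n⇒m≤1+n ℕ.≤-refl) (≡.trans (≡.sym (moment-previous i i)) Mq≡0)))
    a-eq : moment 1ℚ p (suc k) ≡ α k q p ℚ.* moment 1ℚ p k ℚ.+ β k q p ℚ.* moment 0ℚ q k
    a-eq = ≡.sym (begin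
      α k q p ℚ.* moment 1ℚ p k ℚ.+ β k q p ℚ.* moment 0ℚ q k
        ≡⟨ ≡.cong (ℚ._+ β k q p ℚ.* moment 0ℚ q k) (*-inverse-cancel (moment 1ℚ p (suc k) ℚ.- β k q p ℚ.* moment 0ℚ q k) (nd k ℕ.≤-refl)) ⟩
      (moment 1ℚ p (suc k) ℚ.- β k q p ℚ.* moment 0ℚ q k) ℚ.+ β k q p ℚ.* moment 0ℚ q k
        ≡⟨ solve 2 (λ x y → (x :- y) :+ y := x) ≡.refl (moment 1ℚ p (suc k)) (β k q p ℚ.* moment 0ℚ q k) ⟩
      moment 1ℚ p (suc k) ∎)

  ⟨e,act⟩ : ∀ k → Nondegenerate k → ∀ s → length s ≤ k → ⟨ e k , act 1ℚ s j ⟩ ≡ moment 1ℚ (basis k) (length s)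
  ⟨e,act⟩ k nd s s≤k = krylov s (e k) j (λ i i<s → basis-orthogonal k nd i (ℕ.<-≤-trans i<s s≤k))

  private
    ⟨e,e⟩ : ∀ k l → Nondegenerate k → l ≤ k → ⟨ e k , e l ⟩ ≡ moment 1ℚ (basis k) l
    ⟨e,e⟩ k l nd l≤k = ≡.trans (⟨e,act⟩ k nd (basis l) (≡.subst (_≤ k) (≡.sym (length-basis l)) l≤k))
                                (≡.cong (moment 1ℚ (basis k)) (length-basis l))

    vectors : ℕ → List (Vector n)
    vectors zero    = []
    vectors (suc k) = e k ∷ vectors k

    length-vectors : ∀ k → length (vectors k) ≡ k
    length-vectors zero    = ≡.refl
    length-vectors (suc k) = ≡.cong suc (length-vectors k)

    All-vectors : ∀ {P : Vector n → Set} k → (∀ l → l < k → P (e l)) → All P (vectors k)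
    All-vectors zero    Pe = []
    All-vectors (suc k) Pe = Pe k ℕ.≤-refl ∷ All-vectors k (λ l l<k → Pe l (ℕ.m≤n⇒m≤1+n l<k))

    vectors-orthogonal : ∀ k → Nondegenerate k → Orthogonal (vectors k)
    vectors-orthogonal zero    nd = []
    vectors-orthogonal (suc k) nd =
      All-vectors k (λ l l<k → ≡.trans (⟨e,e⟩ k l (nondegenerate-pred nd) (ℕ.<⇒≤ l<k))
                                        (basis-orthogonal k (nondegenerate-pred nd) l l<k))
      ∷ vectors-orthogonal k (nondegenerate-pred nd)

    vectors-nonisotropic : ∀ k → Nondegenerate k → All (λ v → ⟨ v , v ⟩ ≢ 0ℚ) (vectors k)
    vectors-nonisotropic k nd =
      All-vectors k (λ l l<k ⟨e,e⟩≡0 →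
        nd l l<k (≡.trans (≡.sym (⟨e,e⟩ l l (λ i i<l → nd i (ℕ.<-trans i<l l<k)) ℕ.≤-refl)) ⟨e,e⟩≡0))

  record KrylovBasis : Set where
    field
      dimension     : ℕ
      nondegenerate : Nondegenerate dimension
      annihilates   : e dimension ≈ᵥ 0ᵥ

    orthogonal : ∀ k → k ≤ dimension → ∀ i → i < k → moment 1ℚ (basis k) i ≡ 0ℚ
    orthogonal k k≤d = basis-orthogonal k (λ i i<k → nondegenerate i (ℕ.<-≤-trans i<k k≤d))

    minimal : ∀ s → length s < dimension → ¬ (act 1ℚ s j ≈ᵥ 0ᵥ)
    minimal s s<d s-annihilates = nondegenerate (length s) s<d (begin
      pivot (length s)                  ≡⟨ ⟨e,act⟩ (length s) nd s ℕ.≤-refl ⟨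
      ⟨ e (length s) , act 1ℚ s j ⟩     ≡⟨ ⟨⟩-zeroʳ (e (length s)) s-annihilates ⟩
      0ℚ                                ∎)
      where
      nd : Nondegenerate (length s)
      nd i i<s = nondegenerate i (ℕ.<-trans i<s s<d)

  krylovBasis : KrylovBasis
  krylovBasis with first-or-none (λ k → pivot k ≡ 0ℚ) (λ k → pivot k ℚ.≟ 0ℚ) (suc n)
  ... | inj₁ (d , _ , pivot≡0 , nd) = record
    { dimension     = d
    ; nondegenerate = nd
    ; annihilates   = ⟨⟩-definite (e d) (≡.trans (⟨e,e⟩ d d nd ℕ.≤-refl) pivot≡0)
    }
  ... | inj₂ nd = ⊥-elim (ℕ.<-irrefl ≡.refl (≡.subst (ℕ._≤ n) (length-vectors (suc n))
                    (orthogonal-length-≤ (vectors (suc n)) (vectors-orthogonal (suc n) nd) (vectors-nonisotropic (suc n) nd))))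


module RationalEmbedding {c ℓ : Level} (F : CommutativeRing c ℓ) (isField : IsField F) (charZero : CharZero F) where

  open RingKit F
  open RingMorphisms using (IsRingHomomorphism)

  private
    denominator≉0 : ∀ b → ¬ (suc b ×ₙ 1# ≈ 0#)
    denominator≉0 b = charZero b ∘ ≈-trans (natCast≈×ₙ (suc b))

    _⁻¹ᵈ : ℕ → Carrier
    b ⁻¹ᵈ = proj₁ (proj₂ isField (suc b ×ₙ 1#) (denominator≉0 b))

    ⁻¹ᵈ-inverse : ∀ b → suc b ×ₙ 1# * b ⁻¹ᵈ ≈ 1#
    ⁻¹ᵈ-inverse b = proj₂ (proj₂ isField (suc b ×ₙ 1#) (denominator≉0 b))

    inverse-unique : ∀ x y z → x * y ≈ 1# → x * z ≈ 1# → y ≈ z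
    inverse-unique x y z xy≈1 xz≈1 = begin
      y            ≈⟨ *-identityʳ y ⟨
      y * 1#       ≈⟨ *-congˡ xz≈1 ⟨
      y * (x * z)  ≈⟨ solve 3 (λ x y z → y :* (x :* z) := (x :* y) :* z) ≈-refl x y z ⟩
      (x * y) * z  ≈⟨ *-congʳ xy≈1 ⟩
      1# * z       ≈⟨ *-identityˡ z ⟩
      z            ∎

    ⁻¹ᵈ-* : ∀ b e → ℕ.pred (suc b ℕ.* suc e) ⁻¹ᵈ ≈ b ⁻¹ᵈ * e ⁻¹ᵈ
    ⁻¹ᵈ-* b e = inverse-unique (fromℤ (+ (suc b ℕ.* suc e))) _ _ (⁻¹ᵈ-inverse (ℕ.pred (suc b ℕ.* suc e))) (begin
      fromℤ (+ suc b ℤ.* + suc e) * (b ⁻¹ᵈ * e ⁻¹ᵈ)                ≈⟨ *-congʳ (fromℤ-* (+ suc b) (+ suc e)) ⟩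
      (suc b ×ₙ 1# * suc e ×ₙ 1#) * (b ⁻¹ᵈ * e ⁻¹ᵈ)                ≈⟨ solve 4 (λ B E B′ E′ → (B :* E) :* (B′ :* E′) := (B :* B′) :* (E :* E′))
                                                                        ≈-refl (suc b ×ₙ 1#) (suc e ×ₙ 1#) (b ⁻¹ᵈ) (e ⁻¹ᵈ) ⟩
      (suc b ×ₙ 1# * b ⁻¹ᵈ) * (suc e ×ₙ 1# * e ⁻¹ᵈ)                ≈⟨ *-cong (⁻¹ᵈ-inverse b) (⁻¹ᵈ-inverse e) ⟩
      1# * 1#                                                      ≈⟨ *-identityʳ 1# ⟩
      1#                                                           ∎)

    -- mkℚᵘ a b stands for a / (b + 1).
    ψ : ℚᵘ → Carrier
    ψ (mkℚᵘ a b) = fromℤ a * b ⁻¹ᵈ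

    ψ-cong : ∀ {p q} → p ℚᵘ.≃ q → ψ p ≈ ψ q
    ψ-cong {mkℚᵘ a b} {mkℚᵘ a′ b′} (*≡* ab′≡a′b) = begin
      fromℤ a * b ⁻¹ᵈ                                        ≈⟨ *-identityʳ _ ⟨
      fromℤ a * b ⁻¹ᵈ * 1#                                   ≈⟨ *-congˡ (⁻¹ᵈ-inverse b′) ⟨
      fromℤ a * b ⁻¹ᵈ * (fromℤ (+ suc b′) * b′ ⁻¹ᵈ)          ≈⟨ solve 4 (λ a B′ x y → a :* x :* (B′ :* y) := (a :* B′) :* x :* y)
                                                                  ≈-refl (fromℤ a) (fromℤ (+ suc b′)) (b ⁻¹ᵈ) (b′ ⁻¹ᵈ) ⟩
      fromℤ a * fromℤ (+ suc b′) * b ⁻¹ᵈ * b′ ⁻¹ᵈ             ≈⟨ *-congʳ (*-congʳ (≈-trans (≈-sym (fromℤ-* a (+ suc b′)))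
                                                                  (≈-trans (reflexive (≡.cong fromℤ ab′≡a′b)) (fromℤ-* a′ (+ suc b))))) ⟩
      fromℤ a′ * fromℤ (+ suc b) * b ⁻¹ᵈ * b′ ⁻¹ᵈ             ≈⟨ solve 4 (λ a′ B x y → a′ :* B :* x :* y := a′ :* y :* (B :* x))
                                                                  ≈-refl (fromℤ a′) (fromℤ (+ suc b)) (b ⁻¹ᵈ) (b′ ⁻¹ᵈ) ⟩
      fromℤ a′ * b′ ⁻¹ᵈ * (fromℤ (+ suc b) * b ⁻¹ᵈ)          ≈⟨ *-congˡ (⁻¹ᵈ-inverse b) ⟩
      fromℤ a′ * b′ ⁻¹ᵈ * 1#                                 ≈⟨ *-identityʳ _ ⟩
      fromℤ a′ * b′ ⁻¹ᵈ                                      ∎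

    ψ-+ : ∀ p q → ψ (p ℚᵘ.+ q) ≈ ψ p + ψ q
    ψ-+ (mkℚᵘ a b) (mkℚᵘ a′ b′) = begin
      fromℤ (a ℤ.* + suc b′ ℤ.+ a′ ℤ.* + suc b) * ℕ.pred (suc b ℕ.* suc b′) ⁻¹ᵈ
        ≈⟨ *-cong (≈-trans (fromℤ-+ (a ℤ.* + suc b′) _) (+-cong (fromℤ-* a _) (fromℤ-* a′ _))) (⁻¹ᵈ-* b b′) ⟩
      (A * B′ + A′ * B) * (b ⁻¹ᵈ * b′ ⁻¹ᵈ)
        ≈⟨ solve 6 (λ A B A′ B′ x y → (A :* B′ :+ A′ :* B) :* (x :* y) := A :* x :* (B′ :* y) :+ A′ :* y :* (B :* x))
             ≈-refl A B A′ B′ (b ⁻¹ᵈ) (b′ ⁻¹ᵈ) ⟩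
      A * b ⁻¹ᵈ * (B′ * b′ ⁻¹ᵈ) + A′ * b′ ⁻¹ᵈ * (B * b ⁻¹ᵈ)
        ≈⟨ +-cong (≈-trans (*-congˡ (⁻¹ᵈ-inverse b′)) (*-identityʳ _)) (≈-trans (*-congˡ (⁻¹ᵈ-inverse b)) (*-identityʳ _)) ⟩
      A * b ⁻¹ᵈ + A′ * b′ ⁻¹ᵈ
        ∎
      where
      A = fromℤ a
      A′ = fromℤ a′
      B = fromℤ (+ suc b)
      B′ = fromℤ (+ suc b′)

    ψ-* : ∀ p q → ψ (p ℚᵘ.* q) ≈ ψ p * ψ q
    ψ-* (mkℚᵘ a b) (mkℚᵘ a′ b′) = begin
      fromℤ (a ℤ.* a′) * ℕ.pred (suc b ℕ.* suc b′) ⁻¹ᵈ   ≈⟨ *-cong (fromℤ-* a a′) (⁻¹ᵈ-* b b′) ⟩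
      (fromℤ a * fromℤ a′) * (b ⁻¹ᵈ * b′ ⁻¹ᵈ)            ≈⟨ solve 4 (λ A A′ x y → (A :* A′) :* (x :* y) := (A :* x) :* (A′ :* y))
                                                             ≈-refl (fromℤ a) (fromℤ a′) (b ⁻¹ᵈ) (b′ ⁻¹ᵈ) ⟩
      (fromℤ a * b ⁻¹ᵈ) * (fromℤ a′ * b′ ⁻¹ᵈ)            ∎

    ψ-neg : ∀ p → ψ (ℚᵘ.- p) ≈ - ψ p
    ψ-neg (mkℚᵘ a b) = ≈-trans (*-congʳ (fromℤ-neg a)) (≈-sym (-‿distribˡ-* (fromℤ a) (b ⁻¹ᵈ)))

    ψ-isRingHomomorphism : IsRingHomomorphism ℚᵘ.+-*-rawRing rawRing ψ
    ψ-isRingHomomorphism = record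
      { isSemiringHomomorphism = record
        { isNearSemiringHomomorphism = record
          { +-isMonoidHomomorphism = record
            { isMagmaHomomorphism = record { isRelHomomorphism = record { cong = ψ-cong } ; homo = ψ-+ }
            ; ε-homo = zeroˡ _ }
          ; *-homo = ψ-* }
        ; 1#-homo = ⁻¹ᵈ-inverse 0 }
      ; -‿homo = ψ-neg }

  φ : ℚ → Carrier
  φ = ψ ∘ ℚ.toℚᵘ

  φ-isRingHomomorphism : IsRingHomomorphism (CommutativeRing.rawRing ℚ-ring) rawRing φ
  φ-isRingHomomorphism = Composition.isRingHomomorphism ≈-trans ℚ.toℚᵘ-isRingHomomorphism-+-* ψ-isRingHomomorphism

  open IsRingHomomorphism φ-isRingHomomorphism public
    using () renaming (*-homo to φ-*; 1#-homo to φ-1; 0#-homo to φ-0; ⟦⟧-cong to φ-cong)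

  φ-nonzero : ∀ {p} → p ≢ 0ℚ → ¬ (φ p ≈ 0#)
  φ-nonzero {p} p≢0 φp≈0 = proj₁ isField (begin
    1#                             ≈⟨ φ-1 ⟨
    φ 1ℚ                           ≡⟨ ≡.cong φ (Rationals.*-inverseʳ p p≢0) ⟨
    φ (p ℚ.* Rationals._⁻¹ p) ≈⟨ φ-* p _ ⟩
    φ p * φ (Rationals._⁻¹ p) ≈⟨ *-congʳ φp≈0 ⟩
    0# * φ (Rationals._⁻¹ p)  ≈⟨ zeroˡ _ ⟩
    0#                             ∎)


module Pigeonhole {a r} (S : Setoid a r) where

  open Setoid S renaming (sym to ≈-sym; trans to ≈-trans)
  open import Data.List.Membership.Setoid S using (_∈_)

  private
    remove : ∀ {x} ys → x ∈ ys → List Carrier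
    remove (y ∷ ys) (here _)  = ys
    remove (y ∷ ys) (there p) = y ∷ remove ys p

    length-remove : ∀ {x} ys (p : x ∈ ys) → suc (length (remove ys p)) ≡ length ys
    length-remove (y ∷ ys) (here _)  = ≡.refl
    length-remove (y ∷ ys) (there p) = ≡.cong suc (length-remove ys p)

    ∈-remove : ∀ {x z} ys (p : x ∈ ys) → z ∈ ys → ¬ (x ≈ z) → z ∈ remove ys p
    ∈-remove (y ∷ ys) (here x≈y) (here z≈y) x≉z = ⊥-elim (x≉z (≈-trans x≈y (≈-sym z≈y)))
    ∈-remove (y ∷ ys) (here _)   (there q)  _   = q
    ∈-remove (y ∷ ys) (there p)  (here z≈y) _   = here z≈y
    ∈-remove (y ∷ ys) (there p)  (there q)  x≉z = there (∈-remove ys p q x≉z)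

  distinct-⊆-length : ∀ xs ys → AllPairs (λ x y → ¬ (x ≈ y)) xs → All (_∈ ys) xs → length xs ≤ length ys
  distinct-⊆-length []       ys _                []         = z≤n
  distinct-⊆-length (x ∷ xs) ys (x≉xs ∷ distinct) (x∈ys ∷ xs⊆ys) =
    ≡.subst (suc (length xs) ≤_) (length-remove ys x∈ys)
      (s≤s (distinct-⊆-length xs (remove ys x∈ys) distinct
              (All.zipWith (λ (x≉z , z∈ys) → ∈-remove ys x∈ys z∈ys x≉z) (x≉xs , xs⊆ys))))


module Splitting {c ℓ : Level} (R : CommutativeRing c ℓ) where

  open RingKit R
  open Polynomials R

  Separable : Poly → Set (c ⊔ ℓ)
  Separable h = ∀ ρ → eval 1# h ρ ≈ 0# → ¬ (eval 1# (deflate 1# ρ h) ρ ≈ 0#)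

  private
    separable-deflate : ∀ ρ a f → eval 1# (a ∷ f) ρ ≈ 0# → Separable (a ∷ f) →
                        Separable (deflate 1# ρ (a ∷ f))
    separable-deflate ρ a []      root sep μ q-root _ = sep ρ root q-root
    separable-deflate ρ a (b ∷ f) root sep μ q-root q′-root = sep μ h-root (begin
      eval 1# (deflate 1# μ (a ∷ b ∷ f)) μ
        ≈⟨ eval-deflate-deflate 1# ρ μ a b f μ ⟩
      (μ - ρ) * eval 1# (deflate 1# μ (deflate 1# ρ (a ∷ b ∷ f))) μ + eval 1# (deflate 1# ρ (a ∷ b ∷ f)) μ
        ≈⟨ +-cong (≈-trans (*-congˡ q′-root) (zeroʳ _)) q-root ⟩
      0# + 0#
        ≈⟨ +-identityʳ 0# ⟩
      0# ∎)
      where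
      h-root : eval 1# (a ∷ b ∷ f) μ ≈ 0#
      h-root = ≈-trans (eval-deflate-root 1# ρ a (b ∷ f) μ root) (≈-trans (*-congˡ q-root) (zeroʳ _))

  splits : AlgClosed R → ∀ k h → length h ≡ k → Separable h →
           Σ (List Carrier) λ ρs → length ρs ≡ k × Distinct ρs × All (λ ρ → eval 1# h ρ ≈ 0#) ρs
  splits closed zero    []      _    _   = [] , ≡.refl , [] , []
  splits closed (suc k) (a ∷ f) |h|≡ sep with closed (a ∷ f) (λ ())
  ... | ρ , root′ =
    let ρs , |ρs|≡k , distinct , q-roots = splits closed k q |q|≡k (separable-deflate ρ a f root sep)
    in ρ ∷ ρs , ≡.cong suc |ρs|≡k , All.map ρ≉ q-roots ∷ distinct , root ∷ All.map h-root q-roots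
    where
    q : Poly
    q = deflate 1# ρ (a ∷ f)
    |q|≡k : length q ≡ k
    |q|≡k = ≡.trans (length-deflate 1# ρ a f) (ℕ.suc-injective |h|≡)
    root : eval 1# (a ∷ f) ρ ≈ 0#
    root = ≈-trans (reflexive (≡.sym (evalMonic≡eval (a ∷ f) ρ))) root′
    h-root : ∀ {μ} → eval 1# q μ ≈ 0# → eval 1# (a ∷ f) μ ≈ 0#
    h-root {μ} q-root = ≈-trans (eval-deflate-root 1# ρ a f μ root) (≈-trans (*-congˡ q-root) (zeroʳ _))
    ρ≉ : ∀ {μ} → eval 1# q μ ≈ 0# → ¬ (ρ ≈ μ)
    ρ≉ q-root ρ≈μ = sep ρ root (≈-trans (eval-cong-point 1# q ρ≈μ) q-root)


module Spectrum {c ℓ : Level} (F : CommutativeRing c ℓ) (isField : IsField F) (charZero : CharZero F)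
                {n : ℕ} (Γ : Graph n) where

  open RingKit F
  open Vectors F
  open Adjacency F Γ
  open Polynomials F
  open PolynomialAction F Γ
  open Splitting F using (Separable)
  open RationalEmbedding F isField charZero
  open RingHomomorphism ℚ-ring F φ φ-isRingHomomorphism
  open OnGraph Γ
  open RationalPolynomials using (≃-from-pointwise)
  open import Data.List.Membership.Setoid setoid using (_∈_)
  private
    module Q  = Polynomials ℚ-ring
    module QAdj = Adjacency ℚ-ring Γ
    module QV = Vectors ℚ-ring
    module QA = PolynomialAction ℚ-ring Γ
    module L  = Lanczos Γ
  open L.KrylovBasis L.krylovBasis

  j : Vector n
  j _ = 1#

  m : List ℚ
  m = L.basis dimension

  M : Poly
  M = map φ m

  length-M : length M ≡ dimension
  length-M = ≡.trans (List.length-map φ m) (L.length-basis dimension)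

  φ-act₁ : ∀ f → φᵥ (QA.act 1ℚ f L.j) ≈ᵥ act 1# (map φ f) j
  φ-act₁ f i = ≈-trans (φ-act 1ℚ f L.j i) (≈-trans (act-cong-top (map φ f) _ φ-1 i) (act-cong 1# (map φ f) (λ _ → φ-1) i))

  φ-moment : ∀ f i → φ (L.moment 1ℚ f i) ≈ ⟨ act 1# (map φ f) j , A^ i j ⟩
  φ-moment f i = ≈-trans (φ-⟨⟩ (QA.act 1ℚ f L.j) (QAdj.A^ i L.j))
                   (⟨⟩-cong (φ-act₁ f) (λ k → ≈-trans (φ-A^ i L.j k) (A^-cong i (λ _ → φ-1) k)))

  M-annihilates : act 1# M j ≈ᵥ 0ᵥ
  M-annihilates i = ≈-trans (≈-sym (φ-act₁ m i)) (≈-trans (φ-cong (annihilates i)) φ-0)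

  -- For q = (a ∷ f) / (x − ρ), u = q(A) j is a ρ-eigenvector; q is monic of degree
  -- length f, so ⟨ P(A) j , u ⟩ is the nonzero pivot, and it also equals P(ρ)·⟨ j , u ⟩.
  private
    main-at-root : ∀ ρ a f P → act 1# (a ∷ f) j ≈ᵥ 0ᵥ → eval 1# (a ∷ f) ρ ≈ 0# →
                   (∀ i → i < length f → ⟨ act 1# P j , A^ i j ⟩ ≈ 0#) →
                   ¬ (⟨ act 1# P j , A^ (length f) j ⟩ ≈ 0#) → IsMainEigenvalue F Γ ρ
    main-at-root ρ a f P annihilated root P⊥ P-nondegenerate = u , (u≉0 , eigen) , ∑u≉0
      where
      q = deflate 1# ρ (a ∷ f)
      u = act 1# q j
      e = act 1# P j
      eigen : A u ≈ᵥ ρ ·ᵥ u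
      eigen i = x∙y⁻¹≈ε⇒x≈y _ _ (begin
        A u i - ρ * u i                                   ≈⟨ +-congˡ (-‿distribˡ-* ρ (u i)) ⟩
        A u i + (- ρ) * u i                               ≈⟨ +-identityʳ _ ⟨
        (A u i + (- ρ) * u i) + 0#                        ≈⟨ +-congˡ (≈-trans (*-congʳ root) (zeroˡ 1#)) ⟨
        (A u i + (- ρ) * u i) + eval 1# (a ∷ f) ρ * 1#    ≈⟨ act-deflate 1# ρ a f j i ⟨
        act 1# (a ∷ f) j i                                ≈⟨ annihilated i ⟩
        0#                                                ∎)
      ⟨e,u⟩ : ⟨ e , u ⟩ ≈ eval 1# P ρ * ⟨ j , u ⟩
      ⟨e,u⟩ = begin
        ⟨ e , u ⟩                  ≈⟨ act-sym 1# P j u ⟩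
        ⟨ j , act 1# P u ⟩         ≈⟨ ⟨⟩-cong (λ _ → ≈-refl) (act-eigen 1# P ρ u eigen) ⟩
        ⟨ j , eval 1# P ρ ·ᵥ u ⟩   ≈⟨ ⟨⟩-·ʳ _ j u ⟩
        eval 1# P ρ * ⟨ j , u ⟩    ∎
      ⟨j,u⟩≉0 : ¬ (⟨ j , u ⟩ ≈ 0#)
      ⟨j,u⟩≉0 ⟨j,u⟩≈0 = P-nondegenerate (begin
        ⟨ e , A^ (length f) j ⟩    ≈⟨ reflexive (≡.cong (λ k → ⟨ e , A^ k j ⟩) (length-deflate 1# ρ a f)) ⟨
        ⟨ e , A^ (length q) j ⟩    ≈⟨ krylov q e j (λ i i<q → P⊥ i (≡.subst (i <_) (length-deflate 1# ρ a f) i<q)) ⟨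
        ⟨ e , u ⟩                  ≈⟨ ⟨e,u⟩ ⟩
        eval 1# P ρ * ⟨ j , u ⟩    ≈⟨ ≈-trans (*-congˡ ⟨j,u⟩≈0) (zeroʳ _) ⟩
        0#                         ∎)
      ∑u≉0 : ¬ (∑ F u ≈ 0#)
      ∑u≉0 ∑u≈0 = ⟨j,u⟩≉0 (≈-trans (∑-cong (λ i → *-identityˡ (u i))) ∑u≈0)
      u≉0 : ¬ (∀ i → u i ≈ 0#)
      u≉0 u≈0 = ∑u≉0 (∑-0 u≈0)

  root⇒main : ∀ ρ → eval 1# M ρ ≈ 0# → IsMainEigenvalue F Γ ρ
  root⇒main ρ root = from-shape M ≡.refl root
    where
    from-shape : ∀ h → h ≡ M → eval 1# h ρ ≈ 0# → IsMainEigenvalue F Γ ρ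
    from-shape []      _    root = ⊥-elim (proj₁ isField root)
    from-shape (a ∷ f) h≡M root =
      main-at-root ρ a f (map φ p) (≡.subst (λ h → act 1# h j ≈ᵥ 0ᵥ) (≡.sym h≡M) M-annihilates) root
        (λ i i<f → ≈-trans (≈-sym (φ-moment p i)) (≈-trans (φ-cong (orthogonal (length f) (ℕ.<⇒≤ f<d) i i<f)) φ-0))
        (λ ⟨e,Aᶠj⟩≈0 → φ-nonzero (nondegenerate (length f) f<d) (≈-trans (φ-moment p (length f)) ⟨e,Aᶠj⟩≈0))
      where
      p = L.basis (length f)
      f<d : length f < dimension
      f<d = ℕ.≤-reflexive (≡.trans (≡.cong length h≡M) length-M)

  private
    eval-map-monic : ∀ f x → eval 0# (map φ (f ∷ʳ 1ℚ)) x ≈ eval 1# (map φ f) x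
    eval-map-monic f x = begin
      eval 0# (map φ (f ∷ʳ 1ℚ)) x   ≡⟨ ≡.cong (λ g → eval 0# g x) (map-∷ʳ f 1ℚ) ⟩
      eval 0# (map φ f ∷ʳ φ 1ℚ) x   ≈⟨ eval₀-∷ʳ (map φ f) (φ 1ℚ) x ⟩
      eval (φ 1ℚ) (map φ f) x       ≈⟨ eval-cong-top (map φ f) x φ-1 ⟩
      eval 1# (map φ f) x           ∎

    eval-map-product : ∀ s π x → eval 0# (map φ (Q.pmul (s ∷ʳ 1ℚ) (π ∷ʳ 1ℚ))) x ≈ eval 1# (map φ s) x * eval 1# (map φ π) x
    eval-map-product s π x = begin
      eval 0# (map φ (Q.pmul (s ∷ʳ 1ℚ) (π ∷ʳ 1ℚ))) x                  ≈⟨ eval-cong 0# x (map-pmul (s ∷ʳ 1ℚ) (π ∷ʳ 1ℚ)) ⟩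
      eval 0# (pmul (map φ (s ∷ʳ 1ℚ)) (map φ (π ∷ʳ 1ℚ))) x           ≈⟨ eval-pmul (map φ (s ∷ʳ 1ℚ)) _ x ⟩
      eval 0# (map φ (s ∷ʳ 1ℚ)) x * eval 0# (map φ (π ∷ʳ 1ℚ)) x      ≈⟨ *-cong (eval-map-monic s x) (eval-map-monic π x) ⟩
      eval 1# (map φ s) x * eval 1# (map φ π) x                      ∎

  module AtRoot (ρ : Carrier) where

    VanishesAt : ℕ → Set ℓ
    VanishesAt k = Σ (List ℚ) λ π → length π ≡ k × eval 1# (map φ π) ρ ≈ 0#

    module MinimalPolynomial (π : List ℚ) (π-root : eval 1# (map φ π) ρ ≈ 0#)
                   (lower-degrees : ∀ i → i < length π → ¬ VanishesAt i) where

      k : ℕ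
      k = length π

      lower-degree-root⇒zero  : ∀ L τ f → length f ≡ L → L < k → eval (φ τ) (map φ f) ρ ≈ 0# → τ ≡ 0ℚ × Q.AllZero f
      lower-degree-root⇒zero₀ : ∀ L r → length r ≡ L → L ≤ k → eval 0# (map φ r) ρ ≈ 0# → Q.AllZero r

      lower-degree-root⇒zero L τ f |f|≡L L<k root with τ ℚ.≟ 0ℚ
      ... | yes τ≡0 = τ≡0 , lower-degree-root⇒zero₀ L f |f|≡L (ℕ.<⇒≤ L<k)
                              (≈-trans (eval-cong-top (map φ f) ρ (≈-sym (≈-trans (φ-cong τ≡0) φ-0))) root)
      ... | no  τ≢0 = ⊥-elim (lower-degrees L L<k (Q.pscale τ⁻¹ f , ≡.trans (List.length-map _ f) |f|≡L , monic-root))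
        where
        τ⁻¹ : ℚ
        τ⁻¹ = Rationals._⁻¹ τ
        monic-root : eval 1# (map φ (Q.pscale τ⁻¹ f)) ρ ≈ 0#
        monic-root = begin
          eval 1# (map φ (Q.pscale τ⁻¹ f)) ρ                ≈⟨ eval-cong 1# ρ (map-pscale τ⁻¹ f) ⟩
          eval 1# (pscale (φ τ⁻¹) (map φ f)) ρ              ≈⟨ eval-cong-top (pscale (φ τ⁻¹) (map φ f)) ρ 1≈τ⁻¹τ ⟩
          eval (φ τ⁻¹ * φ τ) (pscale (φ τ⁻¹) (map φ f)) ρ   ≈⟨ eval-pscale (φ τ⁻¹) (φ τ) (map φ f) ρ ⟩
          φ τ⁻¹ * eval (φ τ) (map φ f) ρ                    ≈⟨ ≈-trans (*-congˡ root) (zeroʳ _) ⟩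
          0#                                                ∎
          where
          1≈τ⁻¹τ : 1# ≈ φ τ⁻¹ * φ τ
          1≈τ⁻¹τ = ≈-trans (≈-sym φ-1)
                     (≈-trans (reflexive (≡.cong φ (≡.sym (≡.trans (ℚ.*-comm τ⁻¹ τ) (Rationals.*-inverseʳ τ τ≢0)))))
                              (φ-* τ⁻¹ τ))

      lower-degree-root⇒zero₀ zero    []  _    _   _    = []
      lower-degree-root⇒zero₀ (suc L) r |r|≡ L<k root with unsnoc r |r|≡
      ... | g , t , ≡.refl , |g|≡L = All.∷ʳ⁺ (proj₂ t≡0×g≈0) (proj₁ t≡0×g≈0)
        where
        t≡0×g≈0 : t ≡ 0ℚ × Q.AllZero g
        t≡0×g≈0 = lower-degree-root⇒zero L t g |g|≡L L<k (begin
          eval (φ t) (map φ g) ρ       ≈⟨ eval₀-∷ʳ (map φ g) (φ t) ρ ⟨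
          eval 0# (map φ g ∷ʳ φ t) ρ   ≡⟨ ≡.cong (λ h → eval 0# h ρ) (map-∷ʳ g t) ⟨
          eval 0# (map φ (g ∷ʳ t)) ρ   ≈⟨ root ⟩
          0#                           ∎)

      private
        eval-map-remainder : ∀ f s r → (f ∷ʳ 1ℚ) Q.≃ Q.padd (Q.pmul (s ∷ʳ 1ℚ) (π ∷ʳ 1ℚ)) r →
                             eval 0# (map φ r) ρ ≈ eval 1# (map φ f) ρ
        eval-map-remainder f s r f≃sπ+r = begin
          eval 0# (map φ r) ρ                                       ≈⟨ +-identityˡ _ ⟨
          0# + eval 0# (map φ r) ρ                                  ≈⟨ +-congʳ (≈-trans (*-congˡ π-root) (zeroʳ _)) ⟨
          eval 1# (map φ s) ρ * eval 1# (map φ π) ρ + eval 0# (map φ r) ρ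
                                                                    ≈⟨ +-congʳ (eval-map-product s π ρ) ⟨
          eval 0# (map φ sπ) ρ + eval 0# (map φ r) ρ                ≈⟨ eval-padd (map φ sπ) (map φ r) ρ ⟨
          eval 0# (padd (map φ sπ) (map φ r)) ρ                     ≈⟨ eval-cong 0# ρ (map-padd sπ r) ⟨
          eval 0# (map φ (Q.padd sπ r)) ρ                           ≈⟨ ≃⇒eval ρ (map-≃ f≃sπ+r) ⟨
          eval 0# (map φ (f ∷ʳ 1ℚ)) ρ                               ≈⟨ eval-map-monic f ρ ⟩
          eval 1# (map φ f) ρ                                       ∎
          where
          sπ : List ℚ
          sπ = Q.pmul (s ∷ʳ 1ℚ) (π ∷ʳ 1ℚ)

      divides : ∀ f → eval 1# (map φ f) ρ ≈ 0# →
                Σ (List ℚ) λ s → length s ℕ.+ k ≡ length f × (f ∷ʳ 1ℚ) Q.≃ Q.pmul (s ∷ʳ 1ℚ) (π ∷ʳ 1ℚ)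
      divides f f-root with k ℕ.≤? length f
      ... | no  f≱k = ⊥-elim (lower-degrees (length f) (ℕ.≰⇒> f≱k) (f , ≡.refl , f-root))
      ... | yes k≤f with Q.divide π (length f ℕ.∸ k) 1ℚ f (≡.sym (ℕ.m∸n+n≡m k≤f))
      ...   | s , r , |s|≡ , |r|≡k , f≗sπ+r =
        s , ≡.trans (≡.cong (ℕ._+ k) |s|≡) (ℕ.m∸n+n≡m k≤f) ,
        ≃-from-pointwise (f ∷ʳ 1ℚ) sπ (λ x →
          ≡.trans (Q.eval₀-∷ʳ f 1ℚ x) (≡.trans (f≗sπ+r x)
            (≡.trans (≡.cong (Q.eval 1ℚ s x ℚ.* Q.eval 1ℚ π x ℚ.+_) (Q.eval-AllZero x r≈0))
              (≡.trans (ℚ.+-identityʳ _) (≡.sym (eval-sπ x))))))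
        where
        sπ : List ℚ
        sπ = Q.pmul (s ∷ʳ 1ℚ) (π ∷ʳ 1ℚ)
        eval-sπ : ∀ x → Q.eval 0ℚ sπ x ≡ Q.eval 1ℚ s x ℚ.* Q.eval 1ℚ π x
        eval-sπ x = ≡.trans (Q.eval-pmul (s ∷ʳ 1ℚ) (π ∷ʳ 1ℚ) x) (≡.cong₂ ℚ._*_ (Q.eval₀-∷ʳ s 1ℚ x) (Q.eval₀-∷ʳ π 1ℚ x))
        f≃sπ+r : (f ∷ʳ 1ℚ) Q.≃ Q.padd sπ r
        f≃sπ+r = ≃-from-pointwise (f ∷ʳ 1ℚ) (Q.padd sπ r) (λ x →
          ≡.trans (Q.eval₀-∷ʳ f 1ℚ x) (≡.trans (f≗sπ+r x)
            (≡.sym (≡.trans (Q.eval-padd sπ r x) (≡.cong (ℚ._+ Q.eval 0ℚ r x) (eval-sπ x))))))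
        r≈0 : Q.AllZero r
        r≈0 = lower-degree-root⇒zero₀ (length r) r ≡.refl (ℕ.≤-reflexive |r|≡k)
                (≈-trans (eval-map-remainder f s r f≃sπ+r) f-root)

      private
        act-product : ∀ f g h v → (f ∷ʳ 1ℚ) Q.≃ Q.pmul (g ∷ʳ 1ℚ) (h ∷ʳ 1ℚ) →
                      QA.act 1ℚ f v QV.≈ᵥ QA.act 1ℚ g (QA.act 1ℚ h v)
        act-product f g h v f≃gh i =
          ≡.trans (≡.sym (QA.act-∷ʳ f 1ℚ v i))
            (≡.trans (QA.≃⇒act v f≃gh i)
              (≡.trans (QA.act-pmul (g ∷ʳ 1ℚ) (h ∷ʳ 1ℚ) v i)
                (≡.trans (QA.act-∷ʳ g 1ℚ _ i) (QA.act-cong 1ℚ g (QA.act-∷ʳ h 1ℚ v) i))))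

      cofactor-nonroot : ∀ s → length s < dimension → (m ∷ʳ 1ℚ) Q.≃ Q.pmul (s ∷ʳ 1ℚ) (π ∷ʳ 1ℚ) →
                         ¬ (eval 1# (map φ s) ρ ≈ 0#)
      cofactor-nonroot s s<d m≃sπ s-root with divides s s-root
      ... | s₂ , _ , s≃s₂π = minimal s s<d (Rationals.⟨⟩-definite w ⟨w,w⟩≡0)
        where
        πj = QA.act 1ℚ π L.j
        w  = QA.act 1ℚ s L.j
        sπj≈0 : QA.act 1ℚ s πj QV.≈ᵥ QV.0ᵥ
        sπj≈0 i = ≡.trans (≡.sym (act-product m s π L.j m≃sπ i)) (annihilates i)
        ⟨w,w⟩≡0 : QV.⟨ w , w ⟩ ≡ 0ℚ
        ⟨w,w⟩≡0 =
          ≡.trans (QV.⟨⟩-cong {x = w} {x′ = w} (λ _ → ≡.refl) (act-product s s₂ π L.j s≃s₂π))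
            (≡.trans (QA.act-sym 1ℚ s L.j (QA.act 1ℚ s₂ πj))
              (≡.trans (QV.⟨⟩-cong {x = L.j} {x′ = L.j} (λ _ → ≡.refl) (QA.act-comm 1ℚ s 1ℚ s₂ πj))
                (QV.⟨⟩-zeroʳ L.j (QA.act-0ᵥ 1ℚ s₂ sπj≈0))))

      derivative-nonroot : ∀ a g → length (a ∷ g) ≡ k → ¬ (eval 0# (derivative (map φ ((a ∷ g) ∷ʳ 1ℚ))) ρ ≈ 0#)
      derivative-nonroot a g |ag|≡k D≈0 = charZero (length g) (begin
        natCast F (suc (length g))       ≈⟨ natCast≈×ₙ (suc (length g)) ⟩
        suc (length g) ×ₙ 1#             ≈⟨ ×-congʳ (suc (length g)) φ-1 ⟨
        suc (length g) ×ₙ φ 1ℚ           ≈⟨ φ-×ₙ (suc (length g)) 1ℚ ⟨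
        φ top                            ≡⟨ ≡.cong φ top≡0 ⟩
        φ 0ℚ                             ≈⟨ φ-0 ⟩
        0#                               ∎)
        where
        top = RingKit._×ₙ_ ℚ-ring (suc (length g)) 1ℚ
        top-root : eval (φ top) (map φ (Q.weighted 1 g)) ρ ≈ 0#
        top-root = begin
          eval (φ top) (map φ (Q.weighted 1 g)) ρ                 ≈⟨ eval₀-∷ʳ (map φ (Q.weighted 1 g)) (φ top) ρ ⟨
          eval 0# (map φ (Q.weighted 1 g) ∷ʳ φ top) ρ           ≡⟨ ≡.cong (λ h → eval 0# h ρ) (map-∷ʳ (Q.weighted 1 g) top) ⟨
          eval 0# (map φ (Q.weighted 1 g ∷ʳ top)) ρ               ≡⟨ ≡.cong (λ h → eval 0# (map φ h) ρ) (Q.derivative-∷ʳ a g 1ℚ) ⟨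
          eval 0# (map φ (Q.derivative ((a ∷ g) ∷ʳ 1ℚ))) ρ      ≈⟨ eval-cong 0# ρ (map-derivative ((a ∷ g) ∷ʳ 1ℚ)) ⟩
          eval 0# (derivative (map φ ((a ∷ g) ∷ʳ 1ℚ))) ρ        ≈⟨ D≈0 ⟩
          0#                                                    ∎
        top≡0 : top ≡ 0ℚ
        top≡0 = proj₁ (lower-degree-root⇒zero (length g) top (Q.weighted 1 g) (Q.length-weighted 1 g)
                       (≡.subst (length g <_) |ag|≡k ℕ.≤-refl) top-root)

      private
        π-shape : Σ ℚ λ a → Σ (List ℚ) λ g → π ≡ a ∷ g
        π-shape = shape π ≡.refl
          where
          shape : ∀ h → h ≡ π → Σ ℚ λ a → Σ (List ℚ) λ g → π ≡ a ∷ g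
          shape []      h≡π = ⊥-elim (proj₁ isField (≡.subst (λ h → eval 1# (map φ h) ρ ≈ 0#) (≡.sym h≡π) π-root))
          shape (a ∷ g) h≡π = a , g , ≡.sym h≡π

        eval-derivative-deflate : ∀ h → eval 1# h ρ ≈ 0# → eval 0# (derivative (h ∷ʳ 1#)) ρ ≈ eval 1# (deflate 1# ρ h) ρ
        eval-derivative-deflate []      root = ≈-sym root
        eval-derivative-deflate (a ∷ f) _    = eval-derivative-root 1# ρ a f

      -- With m = s·π the derivative of m at ρ is s(ρ)·π′(ρ), and neither factor vanishes.
      no-double-root : eval 1# M ρ ≈ 0# → ¬ (eval 1# (deflate 1# ρ M) ρ ≈ 0#)
      no-double-root M-root M′-root with divides m M-root | π-shape
      ... | s , |s|+k≡d , m≃sπ | a , g , π≡ag =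
        derivative-nonroot a g (≡.cong length (≡.sym π≡ag))
          (≡.subst (λ h → eval 0# (derivative (map φ (h ∷ʳ 1ℚ))) ρ ≈ 0#) π≡ag DΠ≈0)
        where
        S  = eval 1# (map φ s) ρ
        DΠ = eval 0# (derivative (map φ (π ∷ʳ 1ℚ))) ρ
        DS = eval 0# (derivative (map φ (s ∷ʳ 1ℚ))) ρ
        s<d : length s < dimension
        s<d = ≡.subst (length s <_) (≡.trans |s|+k≡d (L.length-basis dimension))
                (ℕ.m<m+n (length s) (≡.subst (0 <_) (≡.sym (≡.cong length π≡ag)) (s≤s z≤n)))
        SDΠ≈0 : S * DΠ ≈ 0#
        SDΠ≈0 = begin
          S * DΠ
            ≈⟨ +-identityˡ _ ⟨
          0# + S * DΠ
            ≈⟨ +-cong (≈-trans (*-congˡ (≈-trans (eval-map-monic π ρ) π-root)) (zeroʳ DS))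
                      (*-congʳ (eval-map-monic s ρ)) ⟨
          DS * eval 0# (map φ (π ∷ʳ 1ℚ)) ρ + eval 0# (map φ (s ∷ʳ 1ℚ)) ρ * DΠ
            ≈⟨ eval-derivative-pmul (map φ (s ∷ʳ 1ℚ)) (map φ (π ∷ʳ 1ℚ)) ρ ⟨
          eval 0# (derivative (pmul (map φ (s ∷ʳ 1ℚ)) (map φ (π ∷ʳ 1ℚ)))) ρ
            ≈⟨ eval-cong 0# ρ (derivative-cong (map-pmul (s ∷ʳ 1ℚ) (π ∷ʳ 1ℚ))) ⟨
          eval 0# (derivative (map φ (Q.pmul (s ∷ʳ 1ℚ) (π ∷ʳ 1ℚ)))) ρ
            ≈⟨ ≃⇒eval-derivative ρ (map-≃ m≃sπ) ⟨
          eval 0# (derivative (map φ (m ∷ʳ 1ℚ))) ρ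
            ≡⟨ ≡.cong (λ h → eval 0# (derivative h) ρ) (map-∷ʳ m 1ℚ) ⟩
          eval 0# (derivative (M ∷ʳ φ 1ℚ)) ρ
            ≈⟨ eval-cong 0# ρ (derivative-cong (∷ʳ-cong M φ-1)) ⟩
          eval 0# (derivative (M ∷ʳ 1#)) ρ
            ≈⟨ eval-derivative-deflate M M-root ⟩
          eval 1# (deflate 1# ρ M) ρ
            ≈⟨ M′-root ⟩
          0#
            ∎
        DΠ≈0 : DΠ ≈ 0#
        DΠ≈0 = field⇒domain isField S DΠ SDΠ≈0 (cofactor-nonroot s s<d m≃sπ)

  -- The least-degree polynomial π is obtained only classically (¬¬-least), which
  -- suffices since separability is a negative statement.
  separable : Separable M
  separable ρ M-root M′-root =
    ¬¬-least VanishesAt dimension (m , L.length-basis dimension , M-root) λ (k , (π , |π|≡k , π-root) , smaller) →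
      MinimalPolynomial.no-double-root π π-root (λ i i<π → smaller i (≡.subst (i <_) |π|≡k i<π)) M-root M′-root
    where open AtRoot ρ

  dimension≤main-count : AlgClosed F → ∀ σs → (∀ σ → IsMainEigenvalue F Γ σ → σ ∈ σs) →
                         dimension ≤ length σs
  dimension≤main-count closed σs complete =
    let ρs , |ρs|≡d , distinct , roots = Splitting.splits F closed dimension M length-M separable
    in ≡.subst (_≤ length σs) |ρs|≡d
         (Pigeonhole.distinct-⊆-length setoid ρs σs distinct (All.map (λ {ρ} root → complete ρ (root⇒main ρ root)) roots))


module Cone {c ℓ : Level} (F : CommutativeRing c ℓ) (isField : IsField F) {n : ℕ} (Γ : Graph n) where

  open RingKit F
  open Vectors F
  open Adjacency F Γ
  open Polynomials F
  open PolynomialAction F Γ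

  j : Vector n
  j _ = 1#

  tailMoments : Poly → Poly
  tailMoments []      = []
  tailMoments (a ∷ f) = ⟨ j , act 1# f j ⟩ ∷ tailMoments f

  length-tailMoments : ∀ f → length (tailMoments f) ≡ length f
  length-tailMoments []      = ≡.refl
  length-tailMoments (a ∷ f) = ≡.cong suc (length-tailMoments f)

  cone-identity : ∀ f x y μ → (∀ i → y + A x i ≈ μ * x i) →
                  ⟨ x , act 1# f j ⟩ ≈ eval 1# f μ * ⟨ x , j ⟩ - y * eval 0# (tailMoments f) μ
  cone-identity []      x y μ rows = begin
    ⟨ x , 1# ·ᵥ j ⟩              ≈⟨ ⟨⟩-·ʳ 1# x j ⟩
    1# * ⟨ x , j ⟩               ≈⟨ solve 3 (λ o X y → o :* X := o :* X :- y :* con 0ℤ) ≈-refl 1# ⟨ x , j ⟩ y ⟩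
    1# * ⟨ x , j ⟩ - y * 0#      ∎
  cone-identity (a ∷ f) x y μ rows = begin
    ⟨ x , a ·ᵥ j +ᵥ A w ⟩                            ≈⟨ ⟨⟩-+ʳ x (a ·ᵥ j) (A w) ⟩
    ⟨ x , a ·ᵥ j ⟩ + ⟨ x , A w ⟩                     ≈⟨ +-cong (⟨⟩-·ʳ a x j) (≈-sym (A-sym x w)) ⟩
    a * X + ⟨ A x , w ⟩                              ≈⟨ +-congˡ (⟨⟩-cong Ax≈ (λ _ → ≈-refl)) ⟩
    a * X + ⟨ μ ·ᵥ x +ᵥ (- y) ·ᵥ j , w ⟩             ≈⟨ +-congˡ (≈-trans (⟨⟩-+ˡ (μ ·ᵥ x) ((- y) ·ᵥ j) w) (+-cong (⟨⟩-·ˡ μ x w) (⟨⟩-·ˡ (- y) j w))) ⟩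
    a * X + (μ * ⟨ x , w ⟩ + (- y) * ⟨ j , w ⟩)      ≈⟨ +-congˡ (+-congʳ (*-congˡ (cone-identity f x y μ rows))) ⟩
    a * X + (μ * (Fμ * X - y * T) + (- y) * W)       ≈⟨ solve 7 (λ a X μ Fμ y T W → a :* X :+ (μ :* (Fμ :* X :- y :* T) :+ (:- y) :* W)
                                                            := (a :+ μ :* Fμ) :* X :- y :* (W :+ μ :* T))
                                                          ≈-refl a X μ Fμ y T W ⟩
    (a + μ * Fμ) * X - y * (W + μ * T)               ∎
    where
    w = act 1# f j
    X = ⟨ x , j ⟩
    W = ⟨ j , w ⟩
    Fμ = eval 1# f μ
    T = eval 0# (tailMoments f) μ
    Ax≈ : A x ≈ᵥ μ ·ᵥ x +ᵥ (- y) ·ᵥ j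
    Ax≈ i = begin
      A x i                    ≈⟨ solve 2 (λ y z → z := (y :+ z) :- y) ≈-refl y (A x i) ⟩
      (y + A x i) - y          ≈⟨ +-cong (rows i) (-‿cong (≈-sym (*-identityʳ y))) ⟩
      μ * x i - y * 1#         ≈⟨ +-congˡ (-‿distribˡ-* y 1#) ⟩
      μ * x i + (- y) * 1#     ∎

  conePolynomial : Poly → Poly
  conePolynomial h = psub (0# ∷ h) (tailMoments h)

  private
    tailMoments≤ : ∀ h → length (tailMoments h) ≤ length (0# ∷ h)
    tailMoments≤ h = ℕ.m≤n⇒m≤1+n (ℕ.≤-reflexive (length-tailMoments h))

  length-conePolynomial : ∀ h → length (conePolynomial h) ≡ suc (length h)
  length-conePolynomial h = length-psub-≤ (0# ∷ h) (tailMoments h) (tailMoments≤ h)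

  eval-conePolynomial : ∀ h μ → eval 1# (conePolynomial h) μ ≈ μ * eval 1# h μ - eval 0# (tailMoments h) μ
  eval-conePolynomial h μ = ≈-trans (eval-psub-≤ 1# (0# ∷ h) (tailMoments h) μ (tailMoments≤ h)) (+-congʳ (+-identityˡ _))

  cone-main⇒root : ∀ h → act 1# h j ≈ᵥ 0ᵥ → ∀ μ → IsMainEigenvalue F (cone Γ) μ → eval 1# (conePolynomial h) μ ≈ 0#
  cone-main⇒root h annihilated μ (x , (_ , eigen) , ∑x≉0) =
    ≈-trans (eval-conePolynomial h μ) (field⇒domain isField y _ y[μh-T]≈0 y≉0)
    where
    y = x zero
    x′ : Vector n
    x′ i = x (suc i)
    ∑x′≈μy : ∑ F x′ ≈ μ * y
    ∑x′≈μy = ≈-trans (≈-sym (+-identityˡ _)) (eigen zero)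
    y≉0 : ¬ (y ≈ 0#)
    y≉0 y≈0 = ∑x≉0 (≈-trans (+-cong y≈0 (≈-trans ∑x′≈μy (≈-trans (*-congˡ y≈0) (zeroʳ μ)))) (+-identityʳ 0#))
    T = eval 0# (tailMoments h) μ
    y[μh-T]≈0 : y * (μ * eval 1# h μ - T) ≈ 0#
    y[μh-T]≈0 = begin
      y * (μ * eval 1# h μ - T)                     ≈⟨ solve 4 (λ y μ H T → y :* (μ :* H :- T) := H :* (μ :* y) :- y :* T)
                                                         ≈-refl y μ (eval 1# h μ) T ⟩
      eval 1# h μ * (μ * y) - y * T                 ≈⟨ +-congʳ (*-congˡ (≈-trans (≈-sym ∑x′≈μy) (∑-cong (λ i → ≈-sym (*-identityʳ (x′ i)))))) ⟩
      eval 1# h μ * ⟨ x′ , j ⟩ - y * T              ≈⟨ cone-identity h x′ y μ (λ i → eigen (suc i)) ⟨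
      ⟨ x′ , act 1# h j ⟩                           ≈⟨ ⟨⟩-zeroʳ x′ annihilated ⟩
      0#                                            ∎

  cone-main-count : ∀ h → act 1# h j ≈ᵥ 0ᵥ → ∀ μs → Distinct μs → All (IsMainEigenvalue F (cone Γ)) μs →
                    length μs ≤ suc (length h)
  cone-main-count h annihilated μs distinct mains =
    ≡.subst (length μs ≤_) (length-conePolynomial h)
      (distinct-roots≤degree (field⇒domain isField) (proj₁ isField) (conePolynomial h) μs distinct
        (All.map (λ {μ} → cone-main⇒root h annihilated μ) mains))


mainTheorem2 : ∀ {c ℓ : Level} (F : CommutativeRing c ℓ) →
    IsField F → CharZero F → AlgClosed F →
    ∀ {n : ℕ} (Γ : Graph n) (r : ℕ) →
    HasExactlyMain F Γ r → HasAtMostMain F (cone Γ) (suc r)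


mainTheorem2 F isField charZero closed Γ r (σs , (_ , _ , complete) , |σs|≡r) μs distinct mains =
  ℕ.≤-trans (Cone.cone-main-count F isField Γ M M-annihilates μs distinct mains)
            (s≤s (≡.subst₂ _≤_ (≡.sym length-M) |σs|≡r (dimension≤main-count closed σs complete)))
  where open Spectrum F isField charZero Γ
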